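{- Let $q$ be a prime power and let $k=k_1\cdots k_m\in\mathbb{N}$ where $k_1,\dots,k_m$ are (not necessarily distinct) prime factors of $q-1$; for each $i$ let $\zeta_{k_i}\in\mathbb{F}_q$ be a primitive $k_i$-th root of unity. Let $f\in\mathbb{F}_q[X]$ be a monic irreducible polynomial of degree $n$ and $\beta\in\mathbb{F}_{q^n}$ a root of $f$. Set $f_0=f$ and for $1\le i\le m$ define $f_i$ as follows: if there exists $g\in\mathbb{F}_q[X]$ with $f_{i-1}(X)=g(X^{k_i})$, put $f_i=g$; otherwise, $f_i$ is the polynomial in $\mathbb{F}_q[X]$ satisfying $$f_i(X^{k_i})=(-1)^{\deg(f_{i-1})(k_i+1)}\prod_{j=1}^{k_i}f_{i-1}(\zeta_{k_i}^{j}X).$$ Then each $f_i$ is a well-defined monic irreducible polynomial in $\mathbb{F}_q[X]$, and $f_m$ is the minimal polynomial of $\beta^k$ over $\mathbb{F}_q$. -}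

module Defs where

open import Level using (Level; _⊔_)
open import Data.Nat as ℕ using (ℕ; zero; suc; _∸_; _≤_; _<_)
open import Data.Nat.Primality using (Prime)
open import Data.Fin using (Fin)
open import Data.List using (List; []; _∷_; _++_; replicate; length; map)
open import Data.Product using (Σ; ∃; ∃-syntax; _×_; _,_)
open import Data.Unit.Polymorphic using (⊤)
open import Relation.Nullary using (¬_)
open import Relation.Binary.PropositionalEquality as ≡ using (_≡_)
open import Function.Bundles using (Inverse)
open import Algebra.Bundles using (CommutativeRing)
open import Algebra.Morphism.Structures using (IsRingHomomorphism)

IsPrimePower : ℕ → Set
IsPrimePower q = ∃[ p ] ∃[ e ] (Prime p × 1 ≤ e × q ≡ p ℕ.^ e)

prodFin : (m : ℕ) → (Fin m → ℕ) → ℕ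
prodFin zero    ks = 1
prodFin (suc m) ks = ks Fin.zero ℕ.* prodFin m (λ i → ks (Fin.suc i))
  where import Data.Fin as Fin

module _ {c ℓ : Level} (R : CommutativeRing c ℓ) where
  open CommutativeRing R

  record IsField : Set (c ⊔ ℓ) where
    field
      nontrivial : ¬ (1# ≈ 0#)
      inverse    : ∀ x → ¬ (x ≈ 0#) → ∃[ y ] (x * y ≈ 1#)

  HasCard : ℕ → Set (c ⊔ ℓ)
  HasCard q = Inverse setoid (≡.setoid (Fin q))

  pow : Carrier → ℕ → Carrier
  pow x zero    = 1#
  pow x (suc n) = x * pow x n

  IsPrimitiveRoot : ℕ → Carrier → Set ℓ
  IsPrimitiveRoot k ζ = pow ζ k ≈ 1# × (∀ j → 1 ≤ j → j < k → ¬ (pow ζ j ≈ 1#))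

  -- Polynomials over R as coefficient lists, constant term first.
  Poly : Set c
  Poly = List Carrier

  -- equality of polynomials: coefficientwise, up to trailing zeros
  infix 4 _≈P_
  _≈P_ : Poly → Poly → Set ℓ
  []       ≈P []       = ⊤
  []       ≈P (b ∷ bs) = b ≈ 0# × [] ≈P bs
  (a ∷ as) ≈P []       = a ≈ 0# × as ≈P []
  (a ∷ as) ≈P (b ∷ bs) = a ≈ b × as ≈P bs

  infixl 6 _+P_
  _+P_ : Poly → Poly → Poly
  []       +P q        = q
  (a ∷ as) +P []       = a ∷ as
  (a ∷ as) +P (b ∷ bs) = (a + b) ∷ (as +P bs)

  _·P_ : Carrier → Poly → Poly
  a ·P p = map (a *_) p

  infixl 7 _*P_
  _*P_ : Poly → Poly → Poly
  []       *P q = []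
  (a ∷ as) *P q = (a ·P q) +P (0# ∷ (as *P q))

  -- p(X) ↦ p(X^k)   (for k ≥ 1)
  compXpow : ℕ → Poly → Poly
  compXpow k []       = []
  compXpow k (a ∷ as) = a ∷ (replicate (k ∸ 1) 0# ++ compXpow k as)

  scaleVar : Carrier → Poly → Poly
  scaleVar a []       = []
  scaleVar a (c ∷ cs) = c ∷ map (a *_) (scaleVar a cs)

  -- ∏_{j=1}^{n} g(j)
  prodP : ℕ → (ℕ → Poly) → Poly
  prodP zero    g = 1# ∷ []
  prodP (suc n) g = prodP n g *P g (suc n)

  Deg : Poly → ℕ → Set (c ⊔ ℓ)
  Deg p d = ∃[ cs ] ∃[ a ] (length cs ≡ d × ¬ (a ≈ 0#) × p ≈P cs ++ (a ∷ []))

  MonicDeg : Poly → ℕ → Set (c ⊔ ℓ)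
  MonicDeg p d = ∃[ cs ] (length cs ≡ d × p ≈P cs ++ (1# ∷ []))

  -- units of R[X] are the nonzero constants (R a field)
  IsUnitP : Poly → Set (c ⊔ ℓ)
  IsUnitP g = ∃[ a ] (¬ (a ≈ 0#) × g ≈P (a ∷ []))

  Irreducible : Poly → Set (c ⊔ ℓ)
  Irreducible p = (∃[ d ] (Deg p d × 1 ≤ d))
                × (∀ g h → p ≈P g *P h → IsUnitP g ⊎ IsUnitP h)
    where open import Data.Sum using (_⊎_)

module _ {c ℓ c′ ℓ′ : Level} (F : CommutativeRing c ℓ) (L : CommutativeRing c′ ℓ′)
         (ι : CommutativeRing.Carrier F → CommutativeRing.Carrier L) where
  private
    module F = CommutativeRing F
    module L = CommutativeRing L

  IsEmbedding : Set (c ⊔ ℓ ⊔ ℓ′)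
  IsEmbedding = IsRingHomomorphism F.rawRing L.rawRing ι

  evalAt : Poly F → L.Carrier → L.Carrier
  evalAt []       x = L.0#
  evalAt (a ∷ as) x = ι a L.+ (x L.* evalAt as x)

  IsMinimalPolynomial : Poly F → L.Carrier → Set (c ⊔ ℓ ⊔ ℓ′)
  IsMinimalPolynomial p α =
    ∃[ n ] ( MonicDeg F p n
           × evalAt p α L.≈ L.0#
           × (∀ g d → Deg F g d → evalAt g α L.≈ L.0# → n ≤ d))

module _ {c ℓ : Level} (F : CommutativeRing c ℓ) where
  open CommutativeRing F
  open import Data.Sum using (_⊎_)
  open import Data.Fin using (inject₁)

  sign : ℕ → ℕ → Carrier
  sign d k = pow F (- 1#) (d ℕ.* (k ℕ.+ 1))

  Step : ℕ → Carrier → Poly F → Poly F → Set (c ⊔ ℓ)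
  Step k ζ fprev fnext =
      _≈P_ F (compXpow F k fnext) fprev
    ⊎ ( ¬ (∃[ g ] _≈P_ F (compXpow F k g) fprev)
      × ∃[ d ] ( Deg F fprev d
               × _≈P_ F (compXpow F k fnext)
                        (_·P_ F (sign d k) (prodP F k (λ j → scaleVar F (pow F ζ j) fprev)))))

  Chain : (m : ℕ) → (Fin m → ℕ) → (Fin m → Carrier) → Poly F
        → (Fin (suc m) → Poly F) → Set (c ⊔ ℓ)
  Chain m ks ζs f fs =
    _≈P_ F (fs Fin.zero) f × (∀ (i : Fin m) → Step (ks i) (ζs i) (fs (inject₁ i)) (fs (Fin.suc i)))
    where import Data.Fin as Fin

-- Each step keeps the invariant "f is monic irreducible with f(γ) = 0", with γ replaced by γ^k.
-- If f = g(X^k), a factorisation of g yields one of f, and g(γ^k) = f(γ) = 0.  Otherwise the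
-- norm N = ±∏_{j=1}^{k} f(ζ^j X) is invariant under X ↦ ζX, so N = g(X^k) with g monic of
-- degree deg f and g(γ^k) = 0.  Suppose a factor h of g with 0 < deg h < deg f had h(γ^k) = 0.
-- No ζ^t γ with 0 < t < k is a root of f: otherwise f would divide f(ζ^t X), so f(ζ^t X) = f
-- (compare constant terms; f(0) ≠ 0 as deg f ≥ 2), and as k is prime f would be a polynomial in X^k.  Since h(X^k) vanishes at every ζ^j γ,
-- the k conjugates f(ζ^j X) therefore divide h(X^k) one after another, giving deg h ≥ deg f.
-- Finally, division with remainder shows that a monic irreducible polynomial with root α is
-- the minimal polynomial of α.

module Submission where

open import Defs
open import Level using (_⊔_)
open import Data.Nat as ℕ using (ℕ; zero; suc; _∸_; z≤n; s≤s)
import Data.Nat.Properties as ℕ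
open import Data.Nat.Tactic.RingSolver using (solve-∀)
open import Data.Nat.Induction using (<-rec)
open import Data.Nat.Divisibility using (_∣_; divides; _∣?_; ∣⇒≤)
open import Data.Nat.DivMod using (_%_; _/_; m≡m%n+[m/n]*n; m%n<n)
open import Data.Nat.Primality using (Prime; euclidsLemma; prime⇒nonZero)
open import Data.Fin as Fin using (Fin; fromℕ; inject₁)
import Data.Fin.Properties as Finₚ
open import Data.List using ([]; _∷_; _++_; replicate; length; drop)
open import Data.Product using (∃-syntax; _×_; _,_; proj₁; proj₂; uncurry)
open import Data.Sum as Sum using (_⊎_; inj₁; inj₂; [_,_]′)
open import Data.Unit.Polymorphic using (tt)
open import Data.Empty using (⊥-elim)
open import Function.Base using (_∘_)
open import Relation.Nullary using (¬_; Dec; yes; no; ¬?; _→-dec_)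
open import Relation.Binary.Definitions using (Tri; tri<; tri≈; tri>)
open import Relation.Binary.PropositionalEquality as ≡ using (_≡_)
open import Relation.Binary.Bundles using (Setoid)
open import Function.Bundles using (Inverse)
open import Algebra.Bundles using (CommutativeRing)
open import Algebra.Morphism.Structures using (IsRingHomomorphism)
import Relation.Binary.Reasoning.Setoid as SetoidReasoning

module RingProperties {c ℓ} (R : CommutativeRing c ℓ) where
  open CommutativeRing R
  open import Algebra.Properties.CommutativeSemiring.Exp commutativeSemiring public
  open import Algebra.Properties.CommutativeSemigroup +-commutativeSemigroup public
    using () renaming (interchange to +-interchange; x∙yz≈y∙xz to +-lcomm)
  open import Algebra.Properties.CommutativeSemigroup *-commutativeSemigroup public
    using () renaming (x∙yz≈y∙xz to *-lcomm)

  pow≈^ : ∀ x n → pow R x n ≈ x ^ n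
  pow≈^ x zero    = refl
  pow≈^ x (suc n) = *-congˡ (pow≈^ x n)

  ^-zeroˡ : ∀ n → 1# ^ n ≈ 1#
  ^-zeroˡ zero    = refl
  ^-zeroˡ (suc n) = trans (*-identityˡ _) (^-zeroˡ n)

quotRem : ∀ k′ r → ∃[ s ] ∃[ t ] (r ≡ s ℕ.+ t ℕ.* suc k′ × s ℕ.< suc k′)
quotRem k′ r = r % suc k′ , r / suc k′ , m≡m%n+[m/n]*n r (suc k′) , m%n<n r (suc k′)

even-or-odd : ∀ n → ∃[ t ] (n ≡ t ℕ.* 2 ⊎ n ≡ 1 ℕ.+ t ℕ.* 2)
even-or-odd n with n % 2 | m≡m%n+[m/n]*n n 2 | m%n<n n 2
... | 0           | n≡2t   | _ = n / 2 , inj₁ n≡2t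
... | 1           | n≡1+2t | _ = n / 2 , inj₂ n≡1+2t
... | suc (suc _) | _      | s≤s (s≤s ())

triangle : ℕ → ℕ
triangle zero    = 0
triangle (suc n) = triangle n ℕ.+ suc n

2*triangle : ∀ n → 2 ℕ.* triangle n ≡ n ℕ.* suc n
2*triangle zero    = ≡.refl
2*triangle (suc n) = ≡.trans (ℕ.*-distribˡ-+ 2 (triangle n) (suc n))
                    (≡.trans (≡.cong (ℕ._+ 2 ℕ.* suc n) (2*triangle n)) (arith n))
  where
  arith : ∀ n → n ℕ.* suc n ℕ.+ 2 ℕ.* suc n ≡ suc n ℕ.* suc (suc n)
  arith = solve-∀

triangle-odd : ∀ t → triangle (1 ℕ.+ t ℕ.* 2) ≡ (1 ℕ.+ t ℕ.* 2) ℕ.* suc t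
triangle-odd t = ℕ.*-cancelˡ-≡ _ _ 2 (≡.trans (2*triangle (1 ℕ.+ t ℕ.* 2)) (arith t))
  where
  arith : ∀ t → (1 ℕ.+ t ℕ.* 2) ℕ.* (2 ℕ.+ t ℕ.* 2) ≡ 2 ℕ.* ((1 ℕ.+ t ℕ.* 2) ℕ.* suc t)
  arith = solve-∀

triangle-even : ∀ t → triangle (t ℕ.* 2) ≡ t ℕ.* suc (t ℕ.* 2)
triangle-even t = ℕ.*-cancelˡ-≡ _ _ 2 (≡.trans (2*triangle (t ℕ.* 2)) (arith t))
  where
  arith : ∀ t → t ℕ.* 2 ℕ.* suc (t ℕ.* 2) ≡ 2 ℕ.* (t ℕ.* suc (t ℕ.* 2))
  arith = solve-∀

module Polynomial {c ℓ} (R : CommutativeRing c ℓ) where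
  open CommutativeRing R hiding (zero)
  open SetoidReasoning setoid
  open RingProperties R

  infixl 6 _⊕_
  _⊕_ : Poly R → Poly R → Poly R
  _⊕_ = _+P_ R

  infixl 7 _⊛_
  _⊛_ : Poly R → Poly R → Poly R
  _⊛_ = _*P_ R

  infixr 8 _•_
  _•_ : Carrier → Poly R → Poly R
  _•_ = _·P_ R

  infixl 9 _⟨_X⟩ _⟨X^_⟩
  _⟨_X⟩ : Poly R → Carrier → Poly R
  p ⟨ a X⟩ = scaleVar R a p

  _⟨X^_⟩ : Poly R → ℕ → Poly R
  p ⟨X^ k ⟩ = compXpow R k p

  coeff : Poly R → ℕ → Carrier
  coeff []      _       = 0#
  coeff (a ∷ p) zero    = a
  coeff (a ∷ p) (suc r) = coeff p r

  -- A record, unlike _≈P_, so that both polynomials can be inferred from an equality proof.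
  infix 4 _≋_
  record _≋_ (p q : Poly R) : Set ℓ where
    constructor coeffwise
    field coeff-≈ : ∀ r → coeff p r ≈ coeff q r
  open _≋_ public

  ≈P⇒≋ : ∀ {p q} → _≈P_ R p q → p ≋ q
  ≈P⇒≋ {p} {q} e = coeffwise (go p q e)
    where
    go : ∀ p q → _≈P_ R p q → ∀ r → coeff p r ≈ coeff q r
    go []      []      _         _       = refl
    go []      (b ∷ q) (b≈0 , _) zero    = sym b≈0
    go []      (b ∷ q) (_ , e)   (suc r) = go [] q e r
    go (a ∷ p) []      (a≈0 , _) zero    = a≈0
    go (a ∷ p) []      (_ , e)   (suc r) = go p [] e r
    go (a ∷ p) (b ∷ q) (a≈b , _) zero    = a≈b
    go (a ∷ p) (b ∷ q) (_ , e)   (suc r) = go p q e r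

  ≋⇒≈P : ∀ {p q} → p ≋ q → _≈P_ R p q
  ≋⇒≈P {p} {q} (coeffwise e) = go p q e
    where
    go : ∀ p q → (∀ r → coeff p r ≈ coeff q r) → _≈P_ R p q
    go []      []      e = tt
    go []      (b ∷ q) e = sym (e zero) , go [] q (e ∘ suc)
    go (a ∷ p) []      e = e zero , go p [] (e ∘ suc)
    go (a ∷ p) (b ∷ q) e = e zero , go p q (e ∘ suc)

  ≋-refl : ∀ {p} → p ≋ p
  ≋-refl = coeffwise λ _ → refl

  ≋-sym : ∀ {p q} → p ≋ q → q ≋ p
  ≋-sym (coeffwise e) = coeffwise λ r → sym (e r)

  ≋-trans : ∀ {p q s} → p ≋ q → q ≋ s → p ≋ s
  ≋-trans (coeffwise e) (coeffwise e′) = coeffwise λ r → trans (e r) (e′ r)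

  ≋-setoid : Setoid c ℓ
  ≋-setoid = record
    { _≈_ = _≋_
    ; isEquivalence = record { refl = ≋-refl ; sym = ≋-sym ; trans = ≋-trans }
    }

  module ≋ = SetoidReasoning ≋-setoid

  ∷-cong : ∀ {a b p q} → a ≈ b → p ≋ q → a ∷ p ≋ b ∷ q
  ∷-cong a≈b (coeffwise e) = coeffwise λ { zero → a≈b ; (suc r) → e r }

  ∷-≋[] : ∀ {a p} → a ≈ 0# → p ≋ [] → a ∷ p ≋ []
  ∷-≋[] a≈0 (coeffwise e) = coeffwise λ { zero → a≈0 ; (suc r) → e r }

  coeff-⊕ : ∀ p q r → coeff (p ⊕ q) r ≈ coeff p r + coeff q r
  coeff-⊕ []      q       r       = sym (+-identityˡ _)
  coeff-⊕ (a ∷ p) []      r       = sym (+-identityʳ _)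
  coeff-⊕ (a ∷ p) (b ∷ q) zero    = refl
  coeff-⊕ (a ∷ p) (b ∷ q) (suc r) = coeff-⊕ p q r

  coeff-• : ∀ a p r → coeff (a • p) r ≈ a * coeff p r
  coeff-• a []      r       = sym (zeroʳ a)
  coeff-• a (b ∷ p) zero    = refl
  coeff-• a (b ∷ p) (suc r) = coeff-• a p r

  coeff-⟨X⟩ : ∀ a p r → coeff (p ⟨ a X⟩) r ≈ a ^ r * coeff p r
  coeff-⟨X⟩ a []      r       = sym (zeroʳ _)
  coeff-⟨X⟩ a (b ∷ p) zero    = sym (*-identityˡ b)
  coeff-⟨X⟩ a (b ∷ p) (suc r) = begin
    coeff (a • p ⟨ a X⟩) r  ≈⟨ coeff-• a (p ⟨ a X⟩) r ⟩
    a * coeff (p ⟨ a X⟩) r  ≈⟨ *-congˡ (coeff-⟨X⟩ a p r) ⟩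
    a * (a ^ r * coeff p r) ≈⟨ *-assoc a (a ^ r) (coeff p r) ⟨
    a ^ suc r * coeff p r   ∎

  ⊕-cong : ∀ {p p′ q q′} → p ≋ p′ → q ≋ q′ → p ⊕ q ≋ p′ ⊕ q′
  ⊕-cong {p} {p′} {q} {q′} e e′ = coeffwise λ r → begin
    coeff (p ⊕ q) r          ≈⟨ coeff-⊕ p q r ⟩
    coeff p r + coeff q r    ≈⟨ +-cong (coeff-≈ e r) (coeff-≈ e′ r) ⟩
    coeff p′ r + coeff q′ r  ≈⟨ coeff-⊕ p′ q′ r ⟨
    coeff (p′ ⊕ q′) r        ∎

  •-cong : ∀ {a b p q} → a ≈ b → p ≋ q → a • p ≋ b • q
  •-cong {a} {b} {p} {q} a≈b e = coeffwise λ r → begin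
    coeff (a • p) r  ≈⟨ coeff-• a p r ⟩
    a * coeff p r    ≈⟨ *-cong a≈b (coeff-≈ e r) ⟩
    b * coeff q r    ≈⟨ coeff-• b q r ⟨
    coeff (b • q) r  ∎

  ⊕-identityʳ : ∀ p → p ⊕ [] ≋ p
  ⊕-identityʳ []      = ≋-refl
  ⊕-identityʳ (a ∷ p) = ≋-refl

  ⊕-zeroʳ : ∀ {p q} → q ≋ [] → p ⊕ q ≋ p
  ⊕-zeroʳ {p} q≈0 = ≋-trans (⊕-cong ≋-refl q≈0) (⊕-identityʳ p)

  ⊕-interchange : ∀ p q s t → (p ⊕ q) ⊕ (s ⊕ t) ≋ (p ⊕ s) ⊕ (q ⊕ t)
  ⊕-interchange p q s t = coeffwise λ r → begin
    coeff ((p ⊕ q) ⊕ (s ⊕ t)) r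
      ≈⟨ trans (coeff-⊕ (p ⊕ q) (s ⊕ t) r) (+-cong (coeff-⊕ p q r) (coeff-⊕ s t r)) ⟩
    (coeff p r + coeff q r) + (coeff s r + coeff t r)
      ≈⟨ +-interchange (coeff p r) (coeff q r) (coeff s r) (coeff t r) ⟩
    (coeff p r + coeff s r) + (coeff q r + coeff t r)
      ≈⟨ trans (coeff-⊕ (p ⊕ s) (q ⊕ t) r) (+-cong (coeff-⊕ p s r) (coeff-⊕ q t r)) ⟨
    coeff ((p ⊕ s) ⊕ (q ⊕ t)) r ∎

  ⊕-lcomm : ∀ p q s → p ⊕ (q ⊕ s) ≋ q ⊕ (p ⊕ s)
  ⊕-lcomm p q s = coeffwise λ r → begin
    coeff (p ⊕ (q ⊕ s)) r                ≈⟨ trans (coeff-⊕ p (q ⊕ s) r) (+-congˡ (coeff-⊕ q s r)) ⟩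
    coeff p r + (coeff q r + coeff s r)  ≈⟨ +-lcomm (coeff p r) (coeff q r) (coeff s r) ⟩
    coeff q r + (coeff p r + coeff s r)  ≈⟨ trans (coeff-⊕ q (p ⊕ s) r) (+-congˡ (coeff-⊕ p s r)) ⟨
    coeff (q ⊕ (p ⊕ s)) r                ∎

  •-distribˡ : ∀ a p q → a • (p ⊕ q) ≋ a • p ⊕ a • q
  •-distribˡ a p q = coeffwise λ r → begin
    coeff (a • (p ⊕ q)) r              ≈⟨ trans (coeff-• a (p ⊕ q) r) (*-congˡ (coeff-⊕ p q r)) ⟩
    a * (coeff p r + coeff q r)        ≈⟨ distribˡ a _ _ ⟩
    a * coeff p r + a * coeff q r
      ≈⟨ trans (coeff-⊕ (a • p) (a • q) r) (+-cong (coeff-• a p r) (coeff-• a q r)) ⟨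
    coeff (a • p ⊕ a • q) r            ∎

  •-distribʳ : ∀ a b p → (a + b) • p ≋ a • p ⊕ b • p
  •-distribʳ a b p = coeffwise λ r → begin
    coeff ((a + b) • p) r              ≈⟨ coeff-• (a + b) p r ⟩
    (a + b) * coeff p r                ≈⟨ distribʳ _ a b ⟩
    a * coeff p r + b * coeff p r
      ≈⟨ trans (coeff-⊕ (a • p) (b • p) r) (+-cong (coeff-• a p r) (coeff-• b p r)) ⟨
    coeff (a • p ⊕ b • p) r            ∎

  •-assoc : ∀ a b p → a • b • p ≋ (a * b) • p
  •-assoc a b p = coeffwise λ r → begin
    coeff (a • b • p) r      ≈⟨ trans (coeff-• a (b • p) r) (*-congˡ (coeff-• b p r)) ⟩
    a * (b * coeff p r)      ≈⟨ *-assoc a b _ ⟨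
    a * b * coeff p r        ≈⟨ coeff-• (a * b) p r ⟨
    coeff ((a * b) • p) r    ∎

  •-zeroˡ : ∀ {a} p → a ≈ 0# → a • p ≋ []
  •-zeroˡ {a} p a≈0 = coeffwise λ r →
    trans (coeff-• a p r) (trans (*-congʳ a≈0) (zeroˡ _))

  •-identityˡ : ∀ p → 1# • p ≋ p
  •-identityˡ p = coeffwise λ r → trans (coeff-• 1# p r) (*-identityˡ _)

  ⊛-zeroʳ : ∀ p → p ⊛ [] ≋ []
  ⊛-zeroʳ []      = ≋-refl
  ⊛-zeroʳ (a ∷ p) = ∷-≋[] refl (⊛-zeroʳ p)

  shift-⊛ : ∀ p q → (0# ∷ p) ⊛ q ≋ 0# ∷ (p ⊛ q)
  shift-⊛ p q = ⊕-cong (•-zeroˡ q refl) ≋-refl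

  const-⊛ : ∀ a p → (a ∷ []) ⊛ p ≋ a • p
  const-⊛ a p = ⊕-zeroʳ (∷-≋[] refl ≋-refl)

  ⊛-congʳ : ∀ p {q q′} → q ≋ q′ → p ⊛ q ≋ p ⊛ q′
  ⊛-congʳ []      e = ≋-refl
  ⊛-congʳ (a ∷ p) e = ⊕-cong (•-cong refl e) (∷-cong refl (⊛-congʳ p e))

  ⊛-consʳ : ∀ p a q → p ⊛ (a ∷ q) ≋ a • p ⊕ (0# ∷ (p ⊛ q))
  ⊛-consʳ []      a q = ≋-sym (∷-≋[] refl ≋-refl)
  ⊛-consʳ (b ∷ p) a q = ∷-cong (+-congʳ (*-comm b a))
    (≋-trans (⊕-cong ≋-refl (⊛-consʳ p a q)) (⊕-lcomm (b • q) (a • p) (0# ∷ (p ⊛ q))))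

  ⊛-comm : ∀ p q → p ⊛ q ≋ q ⊛ p
  ⊛-comm []      q = ≋-sym (⊛-zeroʳ q)
  ⊛-comm (a ∷ p) q = ≋-trans (⊕-cong ≋-refl (∷-cong refl (⊛-comm p q))) (≋-sym (⊛-consʳ q a p))

  ⊛-congˡ : ∀ {p p′} q → p ≋ p′ → p ⊛ q ≋ p′ ⊛ q
  ⊛-congˡ {p} {p′} q e = ≋-trans (⊛-comm p q) (≋-trans (⊛-congʳ q e) (⊛-comm q p′))

  ⊛-cong : ∀ {p p′ q q′} → p ≋ p′ → q ≋ q′ → p ⊛ q ≋ p′ ⊛ q′
  ⊛-cong {p′ = p′} {q = q} e e′ = ≋-trans (⊛-congˡ q e) (⊛-congʳ p′ e′)

  ⊛-≋[]ˡ : ∀ {p} q → p ≋ [] → p ⊛ q ≋ []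
  ⊛-≋[]ˡ q p≈0 = ⊛-congˡ q p≈0

  ⊛-≋[]ʳ : ∀ p {q} → q ≋ [] → p ⊛ q ≋ []
  ⊛-≋[]ʳ p q≈0 = ≋-trans (⊛-congʳ p q≈0) (⊛-zeroʳ p)

  ⊛-identityˡ : ∀ p → (1# ∷ []) ⊛ p ≋ p
  ⊛-identityˡ p = ≋-trans (const-⊛ 1# p) (•-identityˡ p)

  ⊛-distribʳ : ∀ p q s → (p ⊕ q) ⊛ s ≋ p ⊛ s ⊕ q ⊛ s
  ⊛-distribʳ []      q       s = ≋-refl
  ⊛-distribʳ (a ∷ p) []      s = ≋-sym (⊕-identityʳ _)
  ⊛-distribʳ (a ∷ p) (b ∷ q) s = ≋.begin
    (a + b) • s ⊕ (0# ∷ ((p ⊕ q) ⊛ s))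
      ≋.≈⟨ ⊕-cong (•-distribʳ a b s) (∷-cong (sym (+-identityʳ 0#)) (⊛-distribʳ p q s)) ⟩
    (a • s ⊕ b • s) ⊕ ((0# ∷ (p ⊛ s)) ⊕ (0# ∷ (q ⊛ s)))
      ≋.≈⟨ ⊕-interchange (a • s) (b • s) (0# ∷ (p ⊛ s)) (0# ∷ (q ⊛ s)) ⟩
    (a • s ⊕ (0# ∷ (p ⊛ s))) ⊕ (b • s ⊕ (0# ∷ (q ⊛ s))) ≋.∎

  •-⊛ : ∀ a p q → (a • p) ⊛ q ≋ a • (p ⊛ q)
  •-⊛ a []      q = ≋-refl
  •-⊛ a (b ∷ p) q = ≋.begin
    (a * b) • q ⊕ (0# ∷ ((a • p) ⊛ q))
      ≋.≈⟨ ⊕-cong (≋-sym (•-assoc a b q)) (∷-cong (sym (zeroʳ a)) (•-⊛ a p q)) ⟩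
    a • b • q ⊕ a • (0# ∷ (p ⊛ q))
      ≋.≈⟨ •-distribˡ a (b • q) (0# ∷ (p ⊛ q)) ⟨
    a • (b • q ⊕ (0# ∷ (p ⊛ q)))         ≋.∎

  ⊛-assoc : ∀ p q s → (p ⊛ q) ⊛ s ≋ p ⊛ (q ⊛ s)
  ⊛-assoc []      q s = ≋-refl
  ⊛-assoc (a ∷ p) q s = ≋.begin
    (a • q ⊕ (0# ∷ (p ⊛ q))) ⊛ s         ≋.≈⟨ ⊛-distribʳ (a • q) (0# ∷ (p ⊛ q)) s ⟩
    (a • q) ⊛ s ⊕ (0# ∷ (p ⊛ q)) ⊛ s     ≋.≈⟨ ⊕-cong (•-⊛ a q s) (shift-⊛ (p ⊛ q) s) ⟩
    a • (q ⊛ s) ⊕ (0# ∷ ((p ⊛ q) ⊛ s))   ≋.≈⟨ ⊕-cong ≋-refl (∷-cong refl (⊛-assoc p q s)) ⟩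
    a • (q ⊛ s) ⊕ (0# ∷ (p ⊛ (q ⊛ s)))   ≋.∎

  X : Poly R
  X = 0# ∷ 1# ∷ []

  constant≈0⇒X-factor : ∀ p → coeff p 0 ≈ 0# → p ≋ X ⊛ drop 1 p
  constant≈0⇒X-factor []      _   = ≋-sym (⊛-zeroʳ X)
  constant≈0⇒X-factor (a ∷ p) a≈0 = ≋.begin
    a ∷ p                    ≋.≈⟨ ∷-cong (sym a≈0) (⊛-identityˡ p) ⟨
    0# ∷ (1# ∷ []) ⊛ p       ≋.≈⟨ shift-⊛ (1# ∷ []) p ⟨
    X ⊛ p                    ≋.∎

  ⟨X⟩-cong : ∀ {a b p q} → a ≈ b → p ≋ q → p ⟨ a X⟩ ≋ q ⟨ b X⟩
  ⟨X⟩-cong {a} {b} {p} {q} a≈b e = coeffwise λ r → begin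
    coeff (p ⟨ a X⟩) r   ≈⟨ coeff-⟨X⟩ a p r ⟩
    a ^ r * coeff p r    ≈⟨ *-cong (^-congˡ r a≈b) (coeff-≈ e r) ⟩
    b ^ r * coeff q r    ≈⟨ coeff-⟨X⟩ b q r ⟨
    coeff (q ⟨ b X⟩) r   ∎

  ⟨X⟩-⊕ : ∀ a p q → (p ⊕ q) ⟨ a X⟩ ≋ p ⟨ a X⟩ ⊕ q ⟨ a X⟩
  ⟨X⟩-⊕ a p q = coeffwise λ r → begin
    coeff ((p ⊕ q) ⟨ a X⟩) r             ≈⟨ trans (coeff-⟨X⟩ a (p ⊕ q) r) (*-congˡ (coeff-⊕ p q r)) ⟩
    a ^ r * (coeff p r + coeff q r)      ≈⟨ distribˡ _ _ _ ⟩
    a ^ r * coeff p r + a ^ r * coeff q r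
      ≈⟨ trans (coeff-⊕ (p ⟨ a X⟩) (q ⟨ a X⟩) r) (+-cong (coeff-⟨X⟩ a p r) (coeff-⟨X⟩ a q r)) ⟨
    coeff (p ⟨ a X⟩ ⊕ q ⟨ a X⟩) r        ∎

  ⟨X⟩-• : ∀ a b p → (b • p) ⟨ a X⟩ ≋ b • p ⟨ a X⟩
  ⟨X⟩-• a b p = coeffwise λ r → begin
    coeff ((b • p) ⟨ a X⟩) r     ≈⟨ trans (coeff-⟨X⟩ a (b • p) r) (*-congˡ (coeff-• b p r)) ⟩
    a ^ r * (b * coeff p r)      ≈⟨ *-lcomm (a ^ r) b (coeff p r) ⟩
    b * (a ^ r * coeff p r)      ≈⟨ trans (coeff-• b (p ⟨ a X⟩) r) (*-congˡ (coeff-⟨X⟩ a p r)) ⟨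
    coeff (b • p ⟨ a X⟩) r       ∎

  ⟨X⟩-⟨X⟩ : ∀ a b p → p ⟨ b X⟩ ⟨ a X⟩ ≋ p ⟨ a * b X⟩
  ⟨X⟩-⟨X⟩ a b p = coeffwise λ r → begin
    coeff (p ⟨ b X⟩ ⟨ a X⟩) r    ≈⟨ trans (coeff-⟨X⟩ a (p ⟨ b X⟩) r) (*-congˡ (coeff-⟨X⟩ b p r)) ⟩
    a ^ r * (b ^ r * coeff p r)  ≈⟨ *-assoc _ _ _ ⟨
    a ^ r * b ^ r * coeff p r    ≈⟨ *-congʳ (^-distrib-* a b r) ⟨
    (a * b) ^ r * coeff p r      ≈⟨ coeff-⟨X⟩ (a * b) p r ⟨
    coeff (p ⟨ a * b X⟩) r       ∎

  ⟨1X⟩ : ∀ p → p ⟨ 1# X⟩ ≋ p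
  ⟨1X⟩ p = coeffwise λ r → begin
    coeff (p ⟨ 1# X⟩) r   ≈⟨ coeff-⟨X⟩ 1# p r ⟩
    1# ^ r * coeff p r    ≈⟨ *-congʳ (^-zeroˡ r) ⟩
    1# * coeff p r        ≈⟨ *-identityˡ _ ⟩
    coeff p r             ∎

  ⟨X⟩-⊛ : ∀ a p q → (p ⊛ q) ⟨ a X⟩ ≋ p ⟨ a X⟩ ⊛ q ⟨ a X⟩
  ⟨X⟩-⊛ a []      q = ≋-refl
  ⟨X⟩-⊛ a (b ∷ p) q = ≋.begin
    (b • q ⊕ (0# ∷ (p ⊛ q))) ⟨ a X⟩          ≋.≈⟨ ⟨X⟩-⊕ a (b • q) (0# ∷ (p ⊛ q)) ⟩
    (b • q) ⟨ a X⟩ ⊕ (0# ∷ a • (p ⊛ q) ⟨ a X⟩)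
      ≋.≈⟨ ⊕-cong (⟨X⟩-• a b q) (∷-cong refl (•-cong refl (⟨X⟩-⊛ a p q))) ⟩
    b • q ⟨ a X⟩ ⊕ (0# ∷ a • (p ⟨ a X⟩ ⊛ q ⟨ a X⟩))
      ≋.≈⟨ ⊕-cong ≋-refl (∷-cong refl (•-⊛ a (p ⟨ a X⟩) (q ⟨ a X⟩))) ⟨
    b • q ⟨ a X⟩ ⊕ (0# ∷ (a • p ⟨ a X⟩) ⊛ q ⟨ a X⟩) ≋.∎

  ∷-tail : ∀ {a b p q} → a ∷ p ≋ b ∷ q → p ≋ q
  ∷-tail (coeffwise e) = coeffwise (e ∘ suc)

  ∷-tail[] : ∀ {a p} → a ∷ p ≋ [] → p ≋ []
  ∷-tail[] (coeffwise e) = coeffwise (e ∘ suc)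

  infixr 8 X^_·_
  X^_·_ : ℕ → Poly R → Poly R
  X^ j · p = replicate j 0# ++ p

  X^·-cong : ∀ j {p q} → p ≋ q → X^ j · p ≋ X^ j · q
  X^·-cong zero    e = e
  X^·-cong (suc j) e = ∷-cong refl (X^·-cong j e)

  X^·-zero : ∀ j {p} → p ≋ [] → X^ j · p ≋ []
  X^·-zero zero    e = e
  X^·-zero (suc j) e = ∷-≋[] refl (X^·-zero j e)

  X^·-⊕ : ∀ j p q → X^ j · p ⊕ X^ j · q ≋ X^ j · (p ⊕ q)
  X^·-⊕ zero    p q = ≋-refl
  X^·-⊕ (suc j) p q = ∷-cong (+-identityʳ 0#) (X^·-⊕ j p q)

  X^·-• : ∀ a j p → a • X^ j · p ≋ X^ j · (a • p)
  X^·-• a zero    p = ≋-refl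
  X^·-• a (suc j) p = ∷-cong (zeroʳ a) (X^·-• a j p)

  X^·-⊛ : ∀ j p q → (X^ j · p) ⊛ q ≋ X^ j · (p ⊛ q)
  X^·-⊛ zero    p q = ≋-refl
  X^·-⊛ (suc j) p q = ≋-trans (shift-⊛ (X^ j · p) q) (∷-cong refl (X^·-⊛ j p q))

  coeff-X^· : ∀ j p s → coeff (X^ j · p) (j ℕ.+ s) ≡ coeff p s
  coeff-X^· zero    p s = ≡.refl
  coeff-X^· (suc j) p s = coeff-X^· j p s

  coeff-X^·< : ∀ j p {s} → s ℕ.< j → coeff (X^ j · p) s ≈ 0#
  coeff-X^·< (suc j) p {zero}  _          = refl
  coeff-X^·< (suc j) p {suc s} (s≤s s<j) = coeff-X^·< j p s<j

  ⟨X^⟩-zero : ∀ k {p} → p ≋ [] → p ⟨X^ k ⟩ ≋ []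
  ⟨X^⟩-zero k {[]}    _ = ≋-refl
  ⟨X^⟩-zero k {a ∷ p} e = ∷-≋[] (coeff-≈ e 0) (X^·-zero (k ∸ 1) (⟨X^⟩-zero k (∷-tail[] e)))

  ⟨X^⟩-cong : ∀ k {p q} → p ≋ q → p ⟨X^ k ⟩ ≋ q ⟨X^ k ⟩
  ⟨X^⟩-cong k {[]}    {[]}    _ = ≋-refl
  ⟨X^⟩-cong k {[]}    {b ∷ q} e = ≋-sym (⟨X^⟩-zero k (≋-sym e))
  ⟨X^⟩-cong k {a ∷ p} {[]}    e = ⟨X^⟩-zero k e
  ⟨X^⟩-cong k {a ∷ p} {b ∷ q} e =
    ∷-cong (coeff-≈ e 0) (X^·-cong (k ∸ 1) (⟨X^⟩-cong k (∷-tail e)))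

  ⟨X^⟩-⊕ : ∀ k p q → (p ⊕ q) ⟨X^ k ⟩ ≋ p ⟨X^ k ⟩ ⊕ q ⟨X^ k ⟩
  ⟨X^⟩-⊕ k []      q       = ≋-refl
  ⟨X^⟩-⊕ k (a ∷ p) []      = ≋-refl
  ⟨X^⟩-⊕ k (a ∷ p) (b ∷ q) = ∷-cong refl
    (≋-trans (X^·-cong (k ∸ 1) (⟨X^⟩-⊕ k p q)) (≋-sym (X^·-⊕ (k ∸ 1) (p ⟨X^ k ⟩) (q ⟨X^ k ⟩))))

  ⟨X^⟩-• : ∀ k a p → (a • p) ⟨X^ k ⟩ ≋ a • p ⟨X^ k ⟩
  ⟨X^⟩-• k a []      = ≋-refl
  ⟨X^⟩-• k a (b ∷ p) = ∷-cong refl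
    (≋-trans (X^·-cong (k ∸ 1) (⟨X^⟩-• k a p)) (≋-sym (X^·-• a (k ∸ 1) (p ⟨X^ k ⟩))))

  ⟨X^⟩-⊛ : ∀ k p q → (p ⊛ q) ⟨X^ k ⟩ ≋ p ⟨X^ k ⟩ ⊛ q ⟨X^ k ⟩
  ⟨X^⟩-⊛ k []      q = ≋-refl
  ⟨X^⟩-⊛ k (a ∷ p) q = ≋.begin
    (a • q ⊕ (0# ∷ (p ⊛ q))) ⟨X^ k ⟩
      ≋.≈⟨ ⟨X^⟩-⊕ k (a • q) (0# ∷ (p ⊛ q)) ⟩
    (a • q) ⟨X^ k ⟩ ⊕ (0# ∷ X^ (k ∸ 1) · (p ⊛ q) ⟨X^ k ⟩)
      ≋.≈⟨ ⊕-cong (⟨X^⟩-• k a q) (∷-cong refl (X^·-cong (k ∸ 1) (⟨X^⟩-⊛ k p q))) ⟩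
    a • q ⟨X^ k ⟩ ⊕ (0# ∷ X^ (k ∸ 1) · (p ⟨X^ k ⟩ ⊛ q ⟨X^ k ⟩))
      ≋.≈⟨ ⊕-cong ≋-refl (∷-cong refl (X^·-⊛ (k ∸ 1) (p ⟨X^ k ⟩) (q ⟨X^ k ⟩))) ⟨
    a • q ⟨X^ k ⟩ ⊕ (0# ∷ (X^ (k ∸ 1) · p ⟨X^ k ⟩) ⊛ q ⟨X^ k ⟩) ≋.∎

  coeff-⟨X^⟩-multiple : ∀ k p r → coeff (p ⟨X^ suc k ⟩) (r ℕ.* suc k) ≈ coeff p r
  coeff-⟨X^⟩-multiple k []      r       = refl
  coeff-⟨X^⟩-multiple k (a ∷ p) zero    = refl
  coeff-⟨X^⟩-multiple k (a ∷ p) (suc r) =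
    trans (reflexive (coeff-X^· k (p ⟨X^ suc k ⟩) (r ℕ.* suc k))) (coeff-⟨X^⟩-multiple k p r)

  coeff-⟨X^⟩-nonmultiple : ∀ k p {s} r → s ℕ.< k → coeff (p ⟨X^ suc k ⟩) (suc s ℕ.+ r ℕ.* suc k) ≈ 0#
  coeff-⟨X^⟩-nonmultiple k []      r       s<k = refl
  coeff-⟨X^⟩-nonmultiple k (a ∷ p) {s} zero s<k =
    coeff-X^·< k (p ⟨X^ suc k ⟩) (≡.subst (ℕ._< k) (≡.sym (ℕ.+-identityʳ s)) s<k)
  coeff-⟨X^⟩-nonmultiple k (a ∷ p) {s} (suc r) s<k = begin
    coeff (X^ k · p ⟨X^ suc k ⟩) (s ℕ.+ suc (k ℕ.+ r ℕ.* suc k))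
      ≡⟨ ≡.cong (coeff (X^ k · p ⟨X^ suc k ⟩)) (shuffle s k (r ℕ.* suc k)) ⟩
    coeff (X^ k · p ⟨X^ suc k ⟩) (k ℕ.+ (suc s ℕ.+ r ℕ.* suc k))
      ≡⟨ coeff-X^· k (p ⟨X^ suc k ⟩) (suc s ℕ.+ r ℕ.* suc k) ⟩
    coeff (p ⟨X^ suc k ⟩) (suc s ℕ.+ r ℕ.* suc k)
      ≈⟨ coeff-⟨X^⟩-nonmultiple k p r s<k ⟩
    0# ∎
    where
    shuffle : ∀ s k t → s ℕ.+ suc (k ℕ.+ t) ≡ k ℕ.+ (suc s ℕ.+ t)
    shuffle = solve-∀

  ∏ : ℕ → (ℕ → Poly R) → Poly R
  ∏ = prodP R

  ∏-cong : ∀ n {g h} → (∀ j → g j ≋ h j) → ∏ n g ≋ ∏ n h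
  ∏-cong zero    e = ≋-refl
  ∏-cong (suc n) e = ⊛-cong (∏-cong n e) (e (suc n))

  ∏-⟨X⟩ : ∀ a n g → ∏ n g ⟨ a X⟩ ≋ ∏ n (λ j → g j ⟨ a X⟩)
  ∏-⟨X⟩ a zero    g = ≋-refl
  ∏-⟨X⟩ a (suc n) g = ≋-trans (⟨X⟩-⊛ a (∏ n g) (g (suc n))) (⊛-congˡ _ (∏-⟨X⟩ a n g))

  ∏-unfoldˡ : ∀ n g → ∏ (suc n) g ≋ g 1 ⊛ ∏ n (g ∘ suc)
  ∏-unfoldˡ zero    g = ≋-trans (⊛-identityˡ (g 1)) (≋-sym (≋-trans (⊛-comm (g 1) _) (⊛-identityˡ (g 1))))
  ∏-unfoldˡ (suc n) g = ≋-trans (⊛-congˡ (g (suc (suc n))) (∏-unfoldˡ n g))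
                                (⊛-assoc (g 1) (∏ n (g ∘ suc)) (g (suc (suc n))))

  ∏ᶜ : ℕ → (ℕ → Carrier) → Carrier
  ∏ᶜ zero    u = 1#
  ∏ᶜ (suc n) u = ∏ᶜ n u * u (suc n)

  VanishAbove : Poly R → ℕ → Set ℓ
  VanishAbove p d = ∀ r → d ℕ.< r → coeff p r ≈ 0#

  -- The coefficient a may be 0: Leading p d a only says that p has no terms above a X^d.
  record Leading (p : Poly R) (d : ℕ) (a : Carrier) : Set ℓ where
    constructor _,_
    field
      top   : coeff p d ≈ a
      above : VanishAbove p d

  HasDegree : Poly R → ℕ → Set (c ⊔ ℓ)
  HasDegree p d = ∃[ a ] (¬ a ≈ 0# × Leading p d a)

  Leading-cong : ∀ {p q d a} → p ≋ q → Leading p d a → Leading q d a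
  Leading-cong {d = d} e (top , above) =
    trans (sym (coeff-≈ e d)) top , λ r d<r → trans (sym (coeff-≈ e r)) (above r d<r)

  Leading-≈ : ∀ {p d a b} → a ≈ b → Leading p d a → Leading p d b
  Leading-≈ a≈b (top , above) = trans top a≈b , above

  Leading-≡ : ∀ {p d e a} → d ≡ e → Leading p d a → Leading p e a
  Leading-≡ ≡.refl l = l

  Leading-coeff-unique : ∀ {p d a b} → Leading p d a → Leading p d b → a ≈ b
  Leading-coeff-unique (top , _) (top′ , _) = trans (sym top) top′

  Leading-degree-unique : ∀ {p d e a b} → ¬ a ≈ 0# → Leading p d a →
                          ¬ b ≈ 0# → Leading p e b → d ≡ e
  Leading-degree-unique {d = d} {e} a≉0 (top , above) b≉0 (top′ , above′) with ℕ.<-cmp d e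
  ... | tri< d<e _ _ = ⊥-elim (b≉0 (trans (sym top′) (above e d<e)))
  ... | tri≈ _ d≡e _ = d≡e
  ... | tri> _ _ e<d = ⊥-elim (a≉0 (trans (sym top) (above′ d e<d)))

  HasDegree-cong : ∀ {p q d} → p ≋ q → HasDegree p d → HasDegree q d
  HasDegree-cong e (a , a≉0 , l) = a , a≉0 , Leading-cong e l

  HasDegree-unique : ∀ {p d e} → HasDegree p d → HasDegree p e → d ≡ e
  HasDegree-unique (a , a≉0 , l) (b , b≉0 , l′) = Leading-degree-unique a≉0 l b≉0 l′

  Leading-[] : ∀ {p d a} → p ≋ [] → Leading p d a → a ≈ 0#
  Leading-[] {d = d} e (top , _) = trans (sym top) (coeff-≈ e d)

  Leading-• : ∀ {p d a} b → Leading p d a → Leading (b • p) d (b * a)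
  Leading-• {p} {d} b (top , above) =
    trans (coeff-• b p d) (*-congˡ top) ,
    λ r d<r → trans (coeff-• b p r) (trans (*-congˡ (above r d<r)) (zeroʳ b))

  Leading-⟨X⟩ : ∀ {p d a} u → Leading p d a → Leading (p ⟨ u X⟩) d (u ^ d * a)
  Leading-⟨X⟩ {p} {d} u (top , above) =
    trans (coeff-⟨X⟩ u p d) (*-congˡ top) ,
    λ r d<r → trans (coeff-⟨X⟩ u p r) (trans (*-congˡ (above r d<r)) (zeroʳ _))

  Leading-⊛ : ∀ {p q d e a b} → Leading p d a → Leading q e b → Leading (p ⊛ q) (d ℕ.+ e) (a * b)
  Leading-⊛ {[]}    {q} {b = b} (top , _) _ = trans (sym (zeroˡ b)) (*-congʳ top) , λ _ _ → refl
  Leading-⊛ {c ∷ p} {q} {zero} {e} {a} {b} (top , above) lq = Leading-cong (≋-sym c∷p⊛q≋c•q)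
    (Leading-≈ (*-congʳ top) (Leading-• c lq))
    where
    c∷p⊛q≋c•q : (c ∷ p) ⊛ q ≋ c • q
    c∷p⊛q≋c•q = ⊕-zeroʳ (∷-≋[] refl (⊛-≋[]ˡ {p} q (coeffwise λ r → above (suc r) (s≤s z≤n))))
  Leading-⊛ {c ∷ p} {q} {suc d} {e} {a} {b} (top , above) (topq , aboveq) = top′ , above′
    where
    ih : Leading (p ⊛ q) (d ℕ.+ e) (a * b)
    ih = Leading-⊛ {p} {q} (top , λ r d<r → above (suc r) (s≤s d<r)) (topq , aboveq)
    c•q-vanishes : ∀ r → e ℕ.< r → coeff (c • q) r ≈ 0#
    c•q-vanishes r e<r = trans (coeff-• c q r) (trans (*-congˡ (aboveq r e<r)) (zeroʳ c))
    top′ : coeff ((c ∷ p) ⊛ q) (suc (d ℕ.+ e)) ≈ a * b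
    top′ = begin
      coeff ((c ∷ p) ⊛ q) (suc (d ℕ.+ e))            ≈⟨ coeff-⊕ (c • q) (0# ∷ (p ⊛ q)) (suc (d ℕ.+ e)) ⟩
      coeff (c • q) (suc (d ℕ.+ e)) + coeff (p ⊛ q) (d ℕ.+ e)
        ≈⟨ +-cong (c•q-vanishes _ (s≤s (ℕ.m≤n+m e d))) (Leading.top ih) ⟩
      0# + a * b                                     ≈⟨ +-identityˡ _ ⟩
      a * b                                          ∎
    above′ : VanishAbove ((c ∷ p) ⊛ q) (suc (d ℕ.+ e))
    above′ (suc r) (s≤s d+e<r) = begin
      coeff ((c ∷ p) ⊛ q) (suc r)                ≈⟨ coeff-⊕ (c • q) (0# ∷ (p ⊛ q)) (suc r) ⟩
      coeff (c • q) (suc r) + coeff (p ⊛ q) r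
        ≈⟨ +-cong (c•q-vanishes _ (s≤s (ℕ.≤-trans (ℕ.m≤n+m e d) (ℕ.<⇒≤ d+e<r))))
                  (Leading.above ih r d+e<r) ⟩
      0# + 0#                                    ≈⟨ +-identityˡ 0# ⟩
      0#                                         ∎

  Leading-∏ : ∀ n {g d u} → (∀ j → Leading (g j) d (u j)) → Leading (∏ n g) (n ℕ.* d) (∏ᶜ n u)
  Leading-∏ zero    _  = refl , λ { (suc r) _ → refl }
  Leading-∏ (suc n) {g} {d} lg = Leading-≡ (ℕ.+-comm (n ℕ.* d) d) (Leading-⊛ (Leading-∏ n lg) (lg (suc n)))

  ∏-rotate : ∀ n h → h (suc (suc n)) ≋ h 1 → ∏ (suc n) (h ∘ suc) ≋ ∏ (suc n) h
  ∏-rotate n h h[n+2]≈h[1] = ≋.begin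
    ∏ n (h ∘ suc) ⊛ h (suc (suc n))   ≋.≈⟨ ⊛-congʳ (∏ n (h ∘ suc)) h[n+2]≈h[1] ⟩
    ∏ n (h ∘ suc) ⊛ h 1               ≋.≈⟨ ⊛-comm (∏ n (h ∘ suc)) (h 1) ⟩
    h 1 ⊛ ∏ n (h ∘ suc)               ≋.≈⟨ ∏-unfoldˡ n h ⟨
    ∏ (suc n) h                       ≋.∎

  Leading-⟨X^⟩ : ∀ k {g e b} → Leading g e b → Leading (g ⟨X^ suc k ⟩) (e ℕ.* suc k) b
  Leading-⟨X^⟩ k {g} {e} (top , above) = trans (coeff-⟨X^⟩-multiple k g e) top , above′
    where
    above′ : VanishAbove (g ⟨X^ suc k ⟩) (e ℕ.* suc k)
    above′ r ek<r with quotRem k r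
    ... | zero  , t , ≡.refl , _       =
      trans (coeff-⟨X^⟩-multiple k g t) (above t (ℕ.*-cancelʳ-< (suc k) e t ek<r))
    ... | suc s , t , ≡.refl , s≤s s<k = coeff-⟨X^⟩-nonmultiple k g t s<k

  coeff-++ˡ : ∀ cs q {r} → r ℕ.< length cs → coeff (cs ++ q) r ≡ coeff cs r
  coeff-++ˡ (a ∷ cs) q {zero}  _         = ≡.refl
  coeff-++ˡ (a ∷ cs) q {suc r} (s≤s r<n) = coeff-++ˡ cs q r<n

  coeff-++ʳ : ∀ cs q r → coeff (cs ++ q) (length cs ℕ.+ r) ≡ coeff q r
  coeff-++ʳ []       q r = ≡.refl
  coeff-++ʳ (a ∷ cs) q r = coeff-++ʳ cs q r

  Leading-snoc : ∀ cs a → Leading (cs ++ a ∷ []) (length cs) a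
  Leading-snoc cs a = reflexive (≡.trans (≡.cong (coeff (cs ++ a ∷ [])) (≡.sym (ℕ.+-identityʳ _)))
                                         (coeff-++ʳ cs (a ∷ []) 0))
                    , above
    where
    above : VanishAbove (cs ++ a ∷ []) (length cs)
    above r n<r with ℕ.m≤n⇒∃[o]m+o≡n n<r
    ... | o , ≡.refl = reflexive (≡.trans (≡.cong (coeff (cs ++ a ∷ [])) (≡.sym (ℕ.+-suc (length cs) o)))
                                          (coeff-++ʳ cs (a ∷ []) (suc o)))

  Leading-agree : ∀ {p q d a} → Leading p d a → Leading q d a →
                  (∀ r → r ℕ.< d → coeff p r ≈ coeff q r) → p ≋ q
  Leading-agree {p} {q} {d} (top , above) (top′ , above′) below = coeffwise λ r → case r (ℕ.<-cmp r d)
    where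
    case : ∀ r → Tri (r ℕ.< d) (r ≡ d) (d ℕ.< r) → coeff p r ≈ coeff q r
    case r (tri< r<d _ _)      = below r r<d
    case r (tri≈ _ ≡.refl _)   = trans top (sym top′)
    case r (tri> _ _ d<r)      = trans (above r d<r) (sym (above′ r d<r))

  tabulateCoeffs : ℕ → (ℕ → Carrier) → Poly R
  tabulateCoeffs zero    u = []
  tabulateCoeffs (suc n) u = u 0 ∷ tabulateCoeffs n (u ∘ suc)

  length-tabulateCoeffs : ∀ n u → length (tabulateCoeffs n u) ≡ n
  length-tabulateCoeffs zero    u = ≡.refl
  length-tabulateCoeffs (suc n) u = ≡.cong suc (length-tabulateCoeffs n (u ∘ suc))

  coeff-tabulateCoeffs : ∀ n u {r} → r ℕ.< n → coeff (tabulateCoeffs n u) r ≡ u r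
  coeff-tabulateCoeffs (suc n) u {zero}  _         = ≡.refl
  coeff-tabulateCoeffs (suc n) u {suc r} (s≤s r<n) = coeff-tabulateCoeffs n (u ∘ suc) r<n

  Leading⇒≋snoc : ∀ {p d a} → Leading p d a → p ≋ tabulateCoeffs d (coeff p) ++ a ∷ []
  Leading⇒≋snoc {p} {d} {a} l = Leading-agree l l′ λ r r<d → sym (reflexive (lower-coeffs r r<d))
    where
    cs : Poly R
    cs = tabulateCoeffs d (coeff p)
    l′ : Leading (cs ++ a ∷ []) d a
    l′ = Leading-≡ (length-tabulateCoeffs d (coeff p)) (Leading-snoc cs a)
    lower-coeffs : ∀ r → r ℕ.< d → coeff (cs ++ a ∷ []) r ≡ coeff p r
    lower-coeffs r r<d =
      ≡.trans (coeff-++ˡ cs (a ∷ []) (≡.subst (r ℕ.<_) (≡.sym (length-tabulateCoeffs d (coeff p))) r<d))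
              (coeff-tabulateCoeffs d (coeff p) r<d)

  Deg⇒HasDegree : ∀ {p d} → Deg R p d → HasDegree p d
  Deg⇒HasDegree (cs , a , ≡.refl , a≉0 , e) = a , a≉0 , Leading-cong (≋-sym (≈P⇒≋ e)) (Leading-snoc cs a)

  HasDegree⇒Deg : ∀ {p d} → HasDegree p d → Deg R p d
  HasDegree⇒Deg {p} {d} (a , a≉0 , l) =
    tabulateCoeffs d (coeff p) , a , length-tabulateCoeffs d (coeff p) , a≉0 , ≋⇒≈P (Leading⇒≋snoc l)

  MonicDeg⇒Leading : ∀ {p d} → MonicDeg R p d → Leading p d 1#
  MonicDeg⇒Leading (cs , ≡.refl , e) = Leading-cong (≋-sym (≈P⇒≋ e)) (Leading-snoc cs 1#)

  Leading⇒MonicDeg : ∀ {p d} → Leading p d 1# → MonicDeg R p d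
  Leading⇒MonicDeg {p} {d} l =
    tabulateCoeffs d (coeff p) , length-tabulateCoeffs d (coeff p) , ≋⇒≈P (Leading⇒≋snoc l)

  HasDegree⇒IsUnitP : ∀ {p} → HasDegree p 0 → IsUnitP R p
  HasDegree⇒IsUnitP {p} d₀ with HasDegree⇒Deg d₀
  ... | [] , a , _ , a≉0 , e = a , a≉0 , e

  IsUnitP⇒HasDegree : ∀ {p} → IsUnitP R p → HasDegree p 0
  IsUnitP⇒HasDegree (a , a≉0 , e) = Deg⇒HasDegree ([] , a , ≡.refl , a≉0 , e)

  coeff-beyond : ∀ p {r} → length p ℕ.≤ r → coeff p r ≈ 0#
  coeff-beyond []      _         = refl
  coeff-beyond (a ∷ p) (s≤s n≤r) = coeff-beyond p n≤r

module FieldProperties {c ℓ} (F : CommutativeRing c ℓ) (isField : IsField F) where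
  open CommutativeRing F hiding (zero)
  open IsField isField
  open SetoidReasoning setoid
  open RingProperties F
  open import Algebra.Properties.Ring ring using (-‿distribʳ-*; x∙y⁻¹≈ε⇒x≈y; +-inverseˡ-unique)

  1≉0 : ¬ 1# ≈ 0#
  1≉0 = nontrivial

  cancelˡ-0 : ∀ {a x} → ¬ a ≈ 0# → a * x ≈ 0# → x ≈ 0#
  cancelˡ-0 {a} {x} a≉0 ax≈0 with inverse a a≉0
  ... | a⁻¹ , aa⁻¹≈1 = begin
    x              ≈⟨ *-identityˡ x ⟨
    1# * x         ≈⟨ *-congʳ (trans (sym aa⁻¹≈1) (*-comm a a⁻¹)) ⟩
    a⁻¹ * a * x    ≈⟨ *-assoc a⁻¹ a x ⟩
    a⁻¹ * (a * x)  ≈⟨ *-congˡ ax≈0 ⟩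
    a⁻¹ * 0#       ≈⟨ zeroʳ a⁻¹ ⟩
    0#             ∎

  *-≉0 : ∀ {a b} → ¬ a ≈ 0# → ¬ b ≈ 0# → ¬ a * b ≈ 0#
  *-≉0 a≉0 b≉0 ab≈0 = b≉0 (cancelˡ-0 a≉0 ab≈0)

  ^-≉0 : ∀ {a} n → ¬ a ≈ 0# → ¬ a ^ n ≈ 0#
  ^-≉0 zero    _   = 1≉0
  ^-≉0 (suc n) a≉0 = *-≉0 a≉0 (^-≉0 n a≉0)

  *-identityˡ-unique : ∀ {a x} → ¬ x ≈ 0# → a * x ≈ x → a ≈ 1#
  *-identityˡ-unique {a} {x} x≉0 ax≈x = x∙y⁻¹≈ε⇒x≈y a 1# (cancelˡ-0 x≉0 (begin
    x * (a - 1#)         ≈⟨ distribˡ x a (- 1#) ⟩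
    x * a + x * - 1#     ≈⟨ +-cong (*-comm a x) (-‿distribʳ-* x 1#) ⟨
    a * x + - (x * 1#)   ≈⟨ +-cong ax≈x (-‿cong (*-identityʳ x)) ⟩
    x - x                ≈⟨ -‿inverseʳ x ⟩
    0#                   ∎))

  module _ (_≟_ : ∀ x y → Dec (x ≈ y)) where

    zero-product : ∀ {a b} → a * b ≈ 0# → a ≈ 0# ⊎ b ≈ 0#
    zero-product {a} ab≈0 with a ≟ 0#
    ... | yes a≈0 = inj₁ a≈0
    ... | no  a≉0 = inj₂ (cancelˡ-0 a≉0 ab≈0)

    square-root-of-1 : ∀ {x} → x * x ≈ 1# → ¬ x ≈ 1# → x ≈ - 1#
    square-root-of-1 {x} x²≈1 x≉1 with (x + 1#) ≟ 0#
    ... | yes x+1≈0 = +-inverseˡ-unique x 1# x+1≈0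
    ... | no  x+1≉0 = ⊥-elim (x≉1 (*-identityˡ-unique x+1≉0 (begin
      x * (x + 1#)      ≈⟨ distribˡ x x 1# ⟩
      x * x + x * 1#    ≈⟨ +-cong x²≈1 (*-identityʳ x) ⟩
      1# + x            ≈⟨ +-comm 1# x ⟩
      x + 1#            ∎)))

module PolynomialsOverField {c ℓ} (F : CommutativeRing c ℓ) (isField : IsField F)
                           (_≟_ : ∀ x y → Dec (CommutativeRing._≈_ F x y)) where
  open CommutativeRing F hiding (zero)
  open SetoidReasoning setoid
  open RingProperties F using (+-interchange)
  open import Algebra.Properties.Ring ring using (-‿distribˡ-*)
  open Polynomial F
  open FieldProperties F isField

  zero-or-degree : ∀ p → p ≋ [] ⊎ ∃[ d ] HasDegree p d
  zero-or-degree []      = inj₁ ≋-refl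
  zero-or-degree (a ∷ p) with zero-or-degree p
  ... | inj₂ (d , b , b≉0 , top , above) =
          inj₂ (suc d , b , b≉0 , top , λ { (suc r) (s≤s d<r) → above r d<r })
  ... | inj₁ p≈0 with a ≟ 0#
  ...   | yes a≈0 = inj₁ (∷-≋[] a≈0 p≈0)
  ...   | no  a≉0 = inj₂ (0 , a , a≉0 , refl , λ { (suc r) _ → coeff-≈ p≈0 r })

  HasDegree-⊛ : ∀ {p q d e} → HasDegree p d → HasDegree q e → HasDegree (p ⊛ q) (d ℕ.+ e)
  HasDegree-⊛ (a , a≉0 , lp) (b , b≉0 , lq) = a * b , *-≉0 a≉0 b≉0 , Leading-⊛ lp lq

  VanishFrom : Poly F → ℕ → Set ℓ
  VanishFrom p e = ∀ r → e ℕ.≤ r → coeff p r ≈ 0#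

  VanishFrom⇒degree< : ∀ {p e d} → VanishFrom p e → HasDegree p d → d ℕ.< e
  VanishFrom⇒degree< {d = d} vanish (a , a≉0 , top , _) with d ℕ.<? _
  ... | yes d<e = d<e
  ... | no  d≮e = ⊥-elim (a≉0 (trans (sym top) (vanish d (ℕ.≮⇒≥ d≮e))))

  divide : ∀ {g e b} → ¬ b ≈ 0# → Leading g e b →
           ∀ p → ∃[ Q ] ∃[ R ] (p ≋ Q ⊛ g ⊕ R × VanishFrom R e)
  divide b≉0 lg [] = [] , [] , ≋-refl , λ _ _ → refl
  divide {g} {e} {b} b≉0 lg@(top , above) (c ∷ p) with divide b≉0 lg p | IsField.inverse isField b b≉0
  ... | Q , R , p≈Qg+R , R-vanish | b⁻¹ , bb⁻¹≈1 = Q′ , R′ , ≋-sym Q′g+R′≈c∷p , R′-vanish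
    where
    t : Carrier
    t = coeff (c ∷ R) e
    λ′ : Carrier
    λ′ = t * b⁻¹
    Q′ : Poly F
    Q′ = (0# ∷ Q) ⊕ (λ′ ∷ [])
    R′ : Poly F
    R′ = (c ∷ R) ⊕ (- λ′) • g

    b⁻¹b≈1 : b⁻¹ * b ≈ 1#
    b⁻¹b≈1 = trans (*-comm b⁻¹ b) bb⁻¹≈1

    coeff-R′ : ∀ r → coeff R′ r ≈ coeff (c ∷ R) r + - λ′ * coeff g r
    coeff-R′ r = trans (coeff-⊕ (c ∷ R) ((- λ′) • g) r) (+-congˡ (coeff-• (- λ′) g r))

    coeff-Q′g : ∀ r → coeff (Q′ ⊛ g) r ≈ coeff (0# ∷ Q ⊛ g) r + λ′ * coeff g r
    coeff-Q′g r = begin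
      coeff (Q′ ⊛ g) r                          ≈⟨ coeff-≈ Q′g≈ r ⟩
      coeff ((0# ∷ Q ⊛ g) ⊕ λ′ • g) r           ≈⟨ coeff-⊕ (0# ∷ Q ⊛ g) (λ′ • g) r ⟩
      coeff (0# ∷ Q ⊛ g) r + coeff (λ′ • g) r   ≈⟨ +-congˡ (coeff-• λ′ g r) ⟩
      coeff (0# ∷ Q ⊛ g) r + λ′ * coeff g r     ∎
      where
      Q′g≈ : Q′ ⊛ g ≋ (0# ∷ Q ⊛ g) ⊕ λ′ • g
      Q′g≈ = ≋-trans (⊛-distribʳ (0# ∷ Q) (λ′ ∷ []) g) (⊕-cong (shift-⊛ Q g) (const-⊛ λ′ g))

    cancel : ∀ x y z → x + λ′ * y + (z + - λ′ * y) ≈ x + z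
    cancel x y z = begin
      x + λ′ * y + (z + - λ′ * y)     ≈⟨ +-interchange x (λ′ * y) z (- λ′ * y) ⟩
      x + z + (λ′ * y + - λ′ * y)     ≈⟨ +-congˡ (+-congˡ (-‿distribˡ-* λ′ y)) ⟨
      x + z + (λ′ * y - λ′ * y)       ≈⟨ +-congˡ (-‿inverseʳ (λ′ * y)) ⟩
      x + z + 0#                      ≈⟨ +-identityʳ _ ⟩
      x + z                           ∎

    Q′g+R′≈c∷p : Q′ ⊛ g ⊕ R′ ≋ c ∷ p
    Q′g+R′≈c∷p = coeffwise λ r → begin
      coeff (Q′ ⊛ g ⊕ R′) r
        ≈⟨ coeff-⊕ (Q′ ⊛ g) R′ r ⟩
      coeff (Q′ ⊛ g) r + coeff R′ r
        ≈⟨ +-cong (coeff-Q′g r) (coeff-R′ r) ⟩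
      coeff (0# ∷ Q ⊛ g) r + λ′ * coeff g r + (coeff (c ∷ R) r + - λ′ * coeff g r)
        ≈⟨ cancel _ _ _ ⟩
      coeff (0# ∷ Q ⊛ g) r + coeff (c ∷ R) r
        ≈⟨ coeff-⊕ (0# ∷ Q ⊛ g) (c ∷ R) r ⟨
      coeff ((0# ∷ Q ⊛ g) ⊕ (c ∷ R)) r
        ≈⟨ coeff-≈ (∷-cong (+-identityˡ c) (≋-sym p≈Qg+R)) r ⟩
      coeff (c ∷ p) r ∎

    R′-vanish : VanishFrom R′ e
    R′-vanish r e≤r with ℕ.m≤n⇒m<n∨m≡n e≤r
    ... | inj₂ ≡.refl = begin
      coeff R′ e                  ≈⟨ coeff-R′ e ⟩
      t + - λ′ * coeff g e        ≈⟨ +-congˡ (trans (*-congˡ top) (sym (-‿distribˡ-* λ′ b))) ⟩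
      t - t * b⁻¹ * b             ≈⟨ +-congˡ (-‿cong (trans (*-assoc t b⁻¹ b) (*-congˡ b⁻¹b≈1))) ⟩
      t - t * 1#                  ≈⟨ +-congˡ (-‿cong (*-identityʳ t)) ⟩
      t - t                       ≈⟨ -‿inverseʳ t ⟩
      0#                          ∎
    ... | inj₁ e<r@(s≤s e≤r′) = begin
      coeff R′ r                       ≈⟨ coeff-R′ r ⟩
      coeff R _ + - λ′ * coeff g r     ≈⟨ +-cong (R-vanish _ e≤r′) (*-congˡ (above r e<r)) ⟩
      0# + - λ′ * 0#                   ≈⟨ +-identityˡ _ ⟩
      - λ′ * 0#                        ≈⟨ zeroʳ _ ⟩
      0#                               ∎

  monic⇒HasDegree : ∀ {p d} → Leading p d 1# → HasDegree p d
  monic⇒HasDegree l = 1# , 1≉0 , l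

  Irreducible-cong : ∀ {p q} → p ≋ q → Irreducible F p → Irreducible F q
  Irreducible-cong p≈q ((d , p-deg , 1≤d) , factor) =
    (d , HasDegree⇒Deg (HasDegree-cong p≈q (Deg⇒HasDegree p-deg)) , 1≤d) ,
    λ g h q≈gh → factor g h (≋⇒≈P (≋-trans p≈q (≈P⇒≋ q≈gh)))

  Irreducible⇒1≤degree : ∀ {p d} → Irreducible F p → HasDegree p d → 1 ℕ.≤ d
  Irreducible⇒1≤degree ((d′ , p-deg , 1≤d′) , _) p-deg′ =
    ≡.subst (1 ℕ.≤_) (HasDegree-unique (Deg⇒HasDegree p-deg) p-deg′) 1≤d′

  irreducible-factors : ∀ {p} → Irreducible F p → ∀ g h → p ≋ g ⊛ h → IsUnitP F g ⊎ IsUnitP F h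
  irreducible-factors (_ , factor) g h p≈gh = factor g h (≋⇒≈P p≈gh)

  IsUnitP-⟨X^⟩ : ∀ k {g} → IsUnitP F (g ⟨X^ suc k ⟩) → IsUnitP F g
  IsUnitP-⟨X^⟩ k {g} unit with IsUnitP⇒HasDegree unit | zero-or-degree g
  ... | a , a≉0 , l | inj₁ g≈0 = ⊥-elim (a≉0 (Leading-[] (⟨X^⟩-zero (suc k) g≈0) l))
  ... | g^-deg | inj₂ (e , b , b≉0 , lg) =
    HasDegree⇒IsUnitP (b , b≉0 , Leading-≡ (ℕ.m*n≡0⇒m≡0 e (suc k) (≡.sym e*k≡0)) lg)
    where
    e*k≡0 : 0 ≡ e ℕ.* suc k
    e*k≡0 = HasDegree-unique g^-deg (b , b≉0 , Leading-⟨X^⟩ k lg)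

module Evaluation {c ℓ c′ ℓ′} (F : CommutativeRing c ℓ) (L : CommutativeRing c′ ℓ′)
                  (ι : CommutativeRing.Carrier F → CommutativeRing.Carrier L)
                  (ι-hom : IsEmbedding F L ι) where
  open Polynomial F
  private
    module F = CommutativeRing F
    module Fᵖ = RingProperties F
  open CommutativeRing L hiding (zero)
  open SetoidReasoning setoid
  open RingProperties L
  open IsRingHomomorphism ι-hom using () renaming
    (⟦⟧-cong to ι-cong; 0#-homo to ι-0#; 1#-homo to ι-1#; +-homo to ι-+; *-homo to ι-*)

  infixl 8 _⟦_⟧
  _⟦_⟧ : Poly F → Carrier → Carrier
  p ⟦ x ⟧ = evalAt F L ι p x

  ι-^ : ∀ a n → ι (a Fᵖ.^ n) ≈ ι a ^ n
  ι-^ a zero    = ι-1#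
  ι-^ a (suc n) = trans (ι-* a (a Fᵖ.^ n)) (*-congˡ (ι-^ a n))

  ι-*-assoc : ∀ a b x → ι a * (ι b * x) ≈ ι (a F.* b) * x
  ι-*-assoc a b x = trans (sym (*-assoc _ _ _)) (*-congʳ (sym (ι-* a b)))

  ⟦⟧-[] : ∀ {p} x → p ≋ [] → p ⟦ x ⟧ ≈ 0#
  ⟦⟧-[] {[]}    x _ = refl
  ⟦⟧-[] {a ∷ p} x e = begin
    ι a + x * p ⟦ x ⟧   ≈⟨ +-cong (trans (ι-cong (coeff-≈ e 0)) ι-0#) (*-congˡ (⟦⟧-[] x (∷-tail[] e))) ⟩
    0# + x * 0#         ≈⟨ +-identityˡ _ ⟩
    x * 0#              ≈⟨ zeroʳ x ⟩
    0#                  ∎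

  ⟦⟧-cong : ∀ {p q} x → p ≋ q → p ⟦ x ⟧ ≈ q ⟦ x ⟧
  ⟦⟧-cong {[]}    {[]}    x _ = refl
  ⟦⟧-cong {[]}    {b ∷ q} x e = sym (⟦⟧-[] x (≋-sym e))
  ⟦⟧-cong {a ∷ p} {[]}    x e = ⟦⟧-[] x e
  ⟦⟧-cong {a ∷ p} {b ∷ q} x e = +-cong (ι-cong (coeff-≈ e 0)) (*-congˡ (⟦⟧-cong x (∷-tail e)))

  ⟦⟧-congʳ : ∀ p {x y} → x ≈ y → p ⟦ x ⟧ ≈ p ⟦ y ⟧
  ⟦⟧-congʳ []      _   = refl
  ⟦⟧-congʳ (a ∷ p) x≈y = +-congˡ (*-cong x≈y (⟦⟧-congʳ p x≈y))

  ⟦const⟧ : ∀ a x → (a ∷ []) ⟦ x ⟧ ≈ ι a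
  ⟦const⟧ a x = trans (+-congˡ (zeroʳ x)) (+-identityʳ _)

  ⟦⊕⟧ : ∀ p q x → (p ⊕ q) ⟦ x ⟧ ≈ p ⟦ x ⟧ + q ⟦ x ⟧
  ⟦⊕⟧ []      q       x = sym (+-identityˡ _)
  ⟦⊕⟧ (a ∷ p) []      x = sym (+-identityʳ _)
  ⟦⊕⟧ (a ∷ p) (b ∷ q) x = begin
    ι (a F.+ b) + x * (p ⊕ q) ⟦ x ⟧             ≈⟨ +-cong (ι-+ a b) (*-congˡ (⟦⊕⟧ p q x)) ⟩
    ι a + ι b + x * (p ⟦ x ⟧ + q ⟦ x ⟧)         ≈⟨ +-congˡ (distribˡ x _ _) ⟩
    ι a + ι b + (x * p ⟦ x ⟧ + x * q ⟦ x ⟧)     ≈⟨ +-interchange _ _ _ _ ⟩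
    ι a + x * p ⟦ x ⟧ + (ι b + x * q ⟦ x ⟧)     ∎

  ⟦•⟧ : ∀ a p x → (a • p) ⟦ x ⟧ ≈ ι a * p ⟦ x ⟧
  ⟦•⟧ a []      x = sym (zeroʳ _)
  ⟦•⟧ a (b ∷ p) x = begin
    ι (a F.* b) + x * (a • p) ⟦ x ⟧      ≈⟨ +-cong (ι-* a b) (*-congˡ (⟦•⟧ a p x)) ⟩
    ι a * ι b + x * (ι a * p ⟦ x ⟧)      ≈⟨ +-congˡ (*-lcomm x (ι a) _) ⟩
    ι a * ι b + ι a * (x * p ⟦ x ⟧)      ≈⟨ distribˡ (ι a) _ _ ⟨
    ι a * (ι b + x * p ⟦ x ⟧)            ∎

  ⟦⊛⟧ : ∀ p q x → (p ⊛ q) ⟦ x ⟧ ≈ p ⟦ x ⟧ * q ⟦ x ⟧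
  ⟦⊛⟧ []      q x = sym (zeroˡ _)
  ⟦⊛⟧ (a ∷ p) q x = begin
    (a • q ⊕ (F.0# ∷ p ⊛ q)) ⟦ x ⟧                ≈⟨ ⟦⊕⟧ (a • q) (F.0# ∷ p ⊛ q) x ⟩
    (a • q) ⟦ x ⟧ + (ι F.0# + x * (p ⊛ q) ⟦ x ⟧)
      ≈⟨ +-cong (⟦•⟧ a q x) (trans (+-cong ι-0# (*-congˡ (⟦⊛⟧ p q x))) (+-identityˡ _)) ⟩
    ι a * q ⟦ x ⟧ + x * (p ⟦ x ⟧ * q ⟦ x ⟧)        ≈⟨ +-congˡ (*-assoc x _ _) ⟨
    ι a * q ⟦ x ⟧ + x * p ⟦ x ⟧ * q ⟦ x ⟧          ≈⟨ distribʳ _ (ι a) _ ⟨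
    (ι a + x * p ⟦ x ⟧) * q ⟦ x ⟧                  ∎

  ⟦⟧-factor : ∀ {p} a b x → p ≋ a ⊛ b → p ⟦ x ⟧ ≈ 0# → a ⟦ x ⟧ * b ⟦ x ⟧ ≈ 0#
  ⟦⟧-factor a b x p≈ab p[x]≈0 = trans (sym (⟦⊛⟧ a b x)) (trans (sym (⟦⟧-cong x p≈ab)) p[x]≈0)

  ⟦⟨X⟩⟧ : ∀ a p x → p ⟨ a X⟩ ⟦ x ⟧ ≈ p ⟦ ι a * x ⟧
  ⟦⟨X⟩⟧ a []      x = refl
  ⟦⟨X⟩⟧ a (b ∷ p) x = +-congˡ (begin
    x * (a • p ⟨ a X⟩) ⟦ x ⟧          ≈⟨ *-congˡ (⟦•⟧ a (p ⟨ a X⟩) x) ⟩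
    x * (ι a * p ⟨ a X⟩ ⟦ x ⟧)        ≈⟨ *-congˡ (*-congˡ (⟦⟨X⟩⟧ a p x)) ⟩
    x * (ι a * p ⟦ ι a * x ⟧)         ≈⟨ *-assoc x (ι a) _ ⟨
    x * ι a * p ⟦ ι a * x ⟧           ≈⟨ *-congʳ (*-comm x (ι a)) ⟩
    ι a * x * p ⟦ ι a * x ⟧           ∎)

  ⟦X^·⟧ : ∀ j p x → (X^ j · p) ⟦ x ⟧ ≈ x ^ j * p ⟦ x ⟧
  ⟦X^·⟧ zero    p x = sym (*-identityˡ _)
  ⟦X^·⟧ (suc j) p x = begin
    ι F.0# + x * (X^ j · p) ⟦ x ⟧     ≈⟨ +-cong ι-0# (*-congˡ (⟦X^·⟧ j p x)) ⟩
    0# + x * (x ^ j * p ⟦ x ⟧)        ≈⟨ +-identityˡ _ ⟩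
    x * (x ^ j * p ⟦ x ⟧)             ≈⟨ *-assoc x _ _ ⟨
    x ^ suc j * p ⟦ x ⟧               ∎

  ⟦⟨X^⟩⟧ : ∀ k p x → p ⟨X^ suc k ⟩ ⟦ x ⟧ ≈ p ⟦ x ^ suc k ⟧
  ⟦⟨X^⟩⟧ k []      x = refl
  ⟦⟨X^⟩⟧ k (a ∷ p) x = +-congˡ (begin
    x * (X^ k · p ⟨X^ suc k ⟩) ⟦ x ⟧     ≈⟨ *-congˡ (⟦X^·⟧ k (p ⟨X^ suc k ⟩) x) ⟩
    x * (x ^ k * p ⟨X^ suc k ⟩ ⟦ x ⟧)    ≈⟨ *-assoc x _ _ ⟨
    x ^ suc k * p ⟨X^ suc k ⟩ ⟦ x ⟧      ≈⟨ *-congˡ (⟦⟨X^⟩⟧ k p x) ⟩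
    x ^ suc k * p ⟦ x ^ suc k ⟧          ∎)

module MinimalPolynomial {c ℓ c′ ℓ′} (F : CommutativeRing c ℓ) (isFieldF : IsField F)
                         (_≟_ : ∀ x y → Dec (CommutativeRing._≈_ F x y))
                         (L : CommutativeRing c′ ℓ′) (isFieldL : IsField L)
                         (ι : CommutativeRing.Carrier F → CommutativeRing.Carrier L)
                         (ι-hom : IsEmbedding F L ι) where
  open Polynomial F
  open PolynomialsOverField F isFieldF _≟_
  open Evaluation F L ι ι-hom
  module F = CommutativeRing F
  open CommutativeRing L hiding (zero)
  open SetoidReasoning setoid
  open IsRingHomomorphism ι-hom using () renaming (⟦⟧-cong to ι-cong; 1#-homo to ι-1#; *-homo to ι-*)

  ι-≉0 : ∀ {a} → ¬ a F.≈ F.0# → ¬ ι a ≈ 0#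
  ι-≉0 {a} a≉0 ιa≈0 with IsField.inverse isFieldF a a≉0
  ... | a⁻¹ , aa⁻¹≈1 = IsField.nontrivial isFieldL (begin
    1#               ≈⟨ ι-1# ⟨
    ι F.1#           ≈⟨ ι-cong aa⁻¹≈1 ⟨
    ι (a F.* a⁻¹)    ≈⟨ ι-* a a⁻¹ ⟩
    ι a * ι a⁻¹      ≈⟨ *-congʳ ιa≈0 ⟩
    0# * ι a⁻¹       ≈⟨ zeroˡ _ ⟩
    0#               ∎)

  unit-not-root : ∀ {g} → IsUnitP F g → ∀ x → ¬ g ⟦ x ⟧ ≈ 0#
  unit-not-root (a , a≉0 , g≈a) x g[x]≈0 =
    ι-≉0 a≉0 (trans (sym (⟦const⟧ a x)) (trans (sym (⟦⟧-cong x (≈P⇒≋ g≈a))) g[x]≈0))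

  remainder-root : ∀ {p x} Q g R → p ≋ Q ⊛ g ⊕ R → p ⟦ x ⟧ ≈ 0# → g ⟦ x ⟧ ≈ 0# → R ⟦ x ⟧ ≈ 0#
  remainder-root {p} {x} Q g R p≈Qg+R p[x]≈0 g[x]≈0 = begin
    R ⟦ x ⟧                            ≈⟨ +-identityˡ _ ⟨
    0# + R ⟦ x ⟧                       ≈⟨ +-congʳ (trans (*-congˡ g[x]≈0) (zeroʳ _)) ⟨
    Q ⟦ x ⟧ * g ⟦ x ⟧ + R ⟦ x ⟧        ≈⟨ +-congʳ (⟦⊛⟧ Q g x) ⟨
    (Q ⊛ g) ⟦ x ⟧ + R ⟦ x ⟧            ≈⟨ ⟦⊕⟧ (Q ⊛ g) R x ⟨
    (Q ⊛ g ⊕ R) ⟦ x ⟧                  ≈⟨ ⟦⟧-cong x p≈Qg+R ⟨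
    p ⟦ x ⟧                            ≈⟨ p[x]≈0 ⟩
    0#                                 ∎

  module _ {f d} (f-deg : HasDegree f d) (f-irr : Irreducible F f)
           {α} (f[α]≈0 : f ⟦ α ⟧ ≈ 0#) where

    degree-minimal : ∀ {g e} → HasDegree g e → g ⟦ α ⟧ ≈ 0# → d ℕ.≤ e
    degree-minimal {g} {e} = <-rec Motive step e g
      where
      Motive : ℕ → Set _
      Motive e = ∀ g → HasDegree g e → g ⟦ α ⟧ ≈ 0# → d ℕ.≤ e
      step : ∀ e → (∀ {e′} → e′ ℕ.< e → Motive e′) → Motive e
      step e rec g (b , b≉0 , lg) g[α]≈0 with d ℕ.≤? e
      ... | yes d≤e = d≤e
      ... | no  d≰e with divide b≉0 lg f
      ...   | Q , R , f≈Qg+R , R-vanish with zero-or-degree R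
      ...     | inj₂ (e′ , R-deg) = ⊥-elim (d≰e (ℕ.≤-trans (rec e′<e R R-deg R[α]≈0) (ℕ.<⇒≤ e′<e)))
        where
        e′<e : e′ ℕ.< e
        e′<e = VanishFrom⇒degree< R-vanish R-deg
        R[α]≈0 : R ⟦ α ⟧ ≈ 0#
        R[α]≈0 = remainder-root Q g R f≈Qg+R f[α]≈0 g[α]≈0
      ...     | inj₁ R≈0 = ⊥-elim ([ g-not-unit , Q-not-unit ]′ (irreducible-factors f-irr g Q f≈gQ))
        where
        f≈gQ : f ≋ g ⊛ Q
        f≈gQ = ≋-trans f≈Qg+R (≋-trans (⊕-zeroʳ R≈0) (⊛-comm Q g))
        g-not-unit : ¬ IsUnitP F g
        g-not-unit g-unit = unit-not-root g-unit α g[α]≈0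
        Q-not-unit : ¬ IsUnitP F Q
        Q-not-unit Q-unit = d≰e (ℕ.≤-reflexive (≡.trans d≡e+0 (ℕ.+-identityʳ e)))
          where
          d≡e+0 : d ≡ e ℕ.+ 0
          d≡e+0 = HasDegree-unique f-deg
                    (HasDegree-cong (≋-sym f≈gQ) (HasDegree-⊛ (b , b≉0 , lg) (IsUnitP⇒HasDegree Q-unit)))

    divides-vanishing : ∀ g → g ⟦ α ⟧ ≈ 0# → ∃[ Q ] (g ≋ f ⊛ Q)
    divides-vanishing g g[α]≈0 with divide (proj₁ (proj₂ f-deg)) (proj₂ (proj₂ f-deg)) g
    ...   | Q , R , g≈Qf+R , R-vanish with zero-or-degree R
    ...     | inj₁ R≈0 = Q , ≋-trans g≈Qf+R (≋-trans (⊕-zeroʳ R≈0) (⊛-comm Q f))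
    ...     | inj₂ (e , R-deg) = ⊥-elim (ℕ.<⇒≱ (VanishFrom⇒degree< R-vanish R-deg)
                                        (degree-minimal R-deg (remainder-root Q f R g≈Qf+R g[α]≈0 f[α]≈0)))

  record MonicIrreducibleRoot (g : Poly F) (δ : Carrier) : Set (c ⊔ ℓ ⊔ ℓ′) where
    field
      degree      : ℕ
      monic       : Leading g degree F.1#
      irreducible : Irreducible F g
      root        : g ⟦ δ ⟧ ≈ 0#

    has-degree : HasDegree g degree
    has-degree = monic⇒HasDegree monic

  MonicIrreducibleRoot⇒IsMinimalPolynomial : ∀ {g δ} → MonicIrreducibleRoot g δ → IsMinimalPolynomial F L ι g δ
  MonicIrreducibleRoot⇒IsMinimalPolynomial gm =
    degree , Leading⇒MonicDeg monic , root ,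
    λ h e h-deg h[δ]≈0 → degree-minimal has-degree irreducible root (Deg⇒HasDegree h-deg) h[δ]≈0
    where open MonicIrreducibleRoot gm

  MonicIrreducibleRoot⇒MonicIrreducible : ∀ {g δ} → MonicIrreducibleRoot g δ →
                                          ∃[ d ] (MonicDeg F g d × Irreducible F g)
  MonicIrreducibleRoot⇒MonicIrreducible gm = degree , Leading⇒MonicDeg monic , irreducible
    where open MonicIrreducibleRoot gm

  MonicIrreducibleRoot-cong : ∀ {g g′ δ δ′} → g ≋ g′ → δ ≈ δ′ →
                              MonicIrreducibleRoot g δ → MonicIrreducibleRoot g′ δ′
  MonicIrreducibleRoot-cong {g} {g′} {δ} {δ′} g≈g′ δ≈δ′ gm = record
    { degree      = degree
    ; monic       = Leading-cong g≈g′ monic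
    ; irreducible = Irreducible-cong g≈g′ irreducible
    ; root        = trans (⟦⟧-cong δ′ (≋-sym g≈g′)) (trans (⟦⟧-congʳ g (sym δ≈δ′)) root)
    }
    where open MonicIrreducibleRoot gm

module RootOfUnity {c ℓ} (F : CommutativeRing c ℓ) (isField : IsField F)
                   (_≟_ : ∀ x y → Dec (CommutativeRing._≈_ F x y))
                   (k′ : ℕ) (ζ : CommutativeRing.Carrier F)
                   (ζ-primitive : IsPrimitiveRoot F (suc k′) ζ) where
  open CommutativeRing F hiding (zero)
  open SetoidReasoning setoid
  open RingProperties F
  open Polynomial F
  open FieldProperties F isField
  open import Algebra.Properties.Ring ring using (-1*x≈-x; -‿involutive)

  k : ℕ
  k = suc k′

  ζ^k≈1 : ζ ^ k ≈ 1#
  ζ^k≈1 = trans (sym (pow≈^ ζ k)) (proj₁ ζ-primitive)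

  ζ^j≉1 : ∀ {j} → 1 ℕ.≤ j → j ℕ.< k → ¬ ζ ^ j ≈ 1#
  ζ^j≉1 {j} 1≤j j<k ζ^j≈1 = proj₂ ζ-primitive j 1≤j j<k (trans (pow≈^ ζ j) ζ^j≈1)

  ζ≉0 : ¬ ζ ≈ 0#
  ζ≉0 ζ≈0 = 1≉0 (trans (sym ζ^k≈1) (trans (*-congʳ ζ≈0) (zeroˡ _)))

  ζ^[t*k]≈1 : ∀ t → ζ ^ (t ℕ.* k) ≈ 1#
  ζ^[t*k]≈1 t = begin
    ζ ^ (t ℕ.* k)   ≈⟨ ^-congʳ ζ (ℕ.*-comm t k) ⟩
    ζ ^ (k ℕ.* t)   ≈⟨ ^-assocʳ ζ k t ⟨
    (ζ ^ k) ^ t     ≈⟨ ^-congˡ t ζ^k≈1 ⟩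
    1# ^ t          ≈⟨ ^-zeroˡ t ⟩
    1#              ∎

  ζ^-mod : ∀ s t → ζ ^ (s ℕ.+ t ℕ.* k) ≈ ζ ^ s
  ζ^-mod s t = trans (^-homo-* ζ s (t ℕ.* k)) (trans (*-congˡ (ζ^[t*k]≈1 t)) (*-identityʳ _))

  order-divides : ∀ {s} → ζ ^ s ≈ 1# → k ∣ s
  order-divides {s} ζ^s≈1 with quotRem k′ s
  ... | zero  , t , ≡.refl , _   = divides t ≡.refl
  ... | suc r , t , ≡.refl , r<k = ⊥-elim (ζ^j≉1 (s≤s z≤n) r<k (trans (sym (ζ^-mod (suc r) t)) ζ^s≈1))

  IsPolynomialInXᵏ : Poly F → Set (c ⊔ ℓ)
  IsPolynomialInXᵏ p = ∃[ G ] (G ⟨X^ k ⟩ ≋ p)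

  coeff-⟨X^k⟩-∤ : ∀ G {r} → ¬ k ∣ r → coeff (G ⟨X^ k ⟩) r ≈ 0#
  coeff-⟨X^k⟩-∤ G {r} k∤r with quotRem k′ r
  ... | zero  , t , ≡.refl , _   = ⊥-elim (k∤r (divides t ≡.refl))
  ... | suc s , t , ≡.refl , s<k = coeff-⟨X^⟩-nonmultiple k′ G t (ℕ.≤-pred s<k)

  ∤-coeffs-vanish⇒IsPolynomialInXᵏ : ∀ p → (∀ r → ¬ k ∣ r → coeff p r ≈ 0#) → IsPolynomialInXᵏ p
  ∤-coeffs-vanish⇒IsPolynomialInXᵏ p vanish = G , coeffwise coeff-G
    where
    n : ℕ
    n = length p
    G : Poly F
    G = tabulateCoeffs n (λ t → coeff p (t ℕ.* k))
    coeff-G : ∀ r → coeff (G ⟨X^ k ⟩) r ≈ coeff p r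
    coeff-G r with k ∣? r
    ... | no k∤r = trans (coeff-⟨X^k⟩-∤ G k∤r) (sym (vanish r k∤r))
    ... | yes (divides t ≡.refl) with t ℕ.<? n
    ...   | yes t<n = trans (coeff-⟨X^⟩-multiple k′ G t) (reflexive (coeff-tabulateCoeffs n _ t<n))
    ...   | no  t≮n =
      trans (coeff-⟨X^⟩-multiple k′ G t) (trans (coeff-beyond G |G|≤t) (sym (coeff-beyond p |p|≤tk)))
      where
      |G|≤t : length G ℕ.≤ t
      |G|≤t = ℕ.≤-trans (ℕ.≤-reflexive (length-tabulateCoeffs n _)) (ℕ.≮⇒≥ t≮n)
      |p|≤tk : length p ℕ.≤ t ℕ.* k
      |p|≤tk = ℕ.≤-trans (ℕ.≮⇒≥ t≮n) (ℕ.m≤m*n t k)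

  IsPolynomialInXᵏ? : ∀ p → Dec (IsPolynomialInXᵏ p)
  IsPolynomialInXᵏ? p with Finₚ.all? {P = λ i → ¬ k ∣ Fin.toℕ i → coeff p (Fin.toℕ i) ≈ 0#}
                                      (λ i → ¬? (k ∣? Fin.toℕ i) →-dec (coeff p (Fin.toℕ i) ≟ 0#))
  ... | yes vanish = yes (∤-coeffs-vanish⇒IsPolynomialInXᵏ p vanish′)
    where
    vanish′ : ∀ r → ¬ k ∣ r → coeff p r ≈ 0#
    vanish′ r with r ℕ.<? length p
    ... | yes r<n = ≡.subst (λ s → ¬ k ∣ s → coeff p s ≈ 0#) (Finₚ.toℕ-fromℕ< r<n) (vanish (Fin.fromℕ< r<n))
    ... | no  r≮n = λ _ → coeff-beyond p (ℕ.≮⇒≥ r≮n)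
  ... | no ¬vanish = no λ (G , G⟨Xᵏ⟩≈p) → ¬vanish λ i k∤i →
          trans (sym (coeff-≈ G⟨Xᵏ⟩≈p (Fin.toℕ i))) (coeff-⟨X^k⟩-∤ G k∤i)

  invariant⇒IsPolynomialInXᵏ : ∀ {p u} → p ⟨ u X⟩ ≋ p → (∀ {s} → u ^ s ≈ 1# → k ∣ s) →
                               IsPolynomialInXᵏ p
  invariant⇒IsPolynomialInXᵏ {p} {u} invariant order∣ = ∤-coeffs-vanish⇒IsPolynomialInXᵏ p vanish
    where
    vanish : ∀ r → ¬ k ∣ r → coeff p r ≈ 0#
    vanish r k∤r with coeff p r ≟ 0#
    ... | yes c≈0 = c≈0
    ... | no  c≉0 = ⊥-elim (k∤r (order∣ (*-identityˡ-unique c≉0 uʳc≈c)))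
      where
      uʳc≈c : u ^ r * coeff p r ≈ coeff p r
      uʳc≈c = trans (sym (coeff-⟨X⟩ u p r)) (coeff-≈ invariant r)

  [-1]ⁿ[-1]ⁿ≈1 : ∀ n → (- 1#) ^ n * (- 1#) ^ n ≈ 1#
  [-1]ⁿ[-1]ⁿ≈1 n = begin
    (- 1#) ^ n * (- 1#) ^ n   ≈⟨ ^-distrib-* (- 1#) (- 1#) n ⟨
    (- 1# * - 1#) ^ n         ≈⟨ ^-congˡ n (trans (-1*x≈-x (- 1#)) (-‿involutive 1#)) ⟩
    1# ^ n                    ≈⟨ ^-zeroˡ n ⟩
    1#                        ∎

  -- The product ζ^(1 + ⋯ + k) of all k-th roots of unity is (-1)^(k+1).
  ∏-roots-sign : (- 1#) ^ (k ℕ.+ 1) * ζ ^ triangle k ≈ 1#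
  ∏-roots-sign with even-or-odd k
  ... | t , inj₂ k≡1+2t = begin
    (- 1#) ^ (k ℕ.+ 1) * ζ ^ triangle k
      ≈⟨ *-cong (^-congʳ (- 1#) k+1≡2[t+1]) (^-congʳ ζ triangle-k≡[t+1]k) ⟩
    (- 1#) ^ (suc t ℕ.+ suc t) * ζ ^ (suc t ℕ.* k)
      ≈⟨ *-cong (^-homo-* (- 1#) (suc t) (suc t)) (ζ^[t*k]≈1 (suc t)) ⟩
    (- 1#) ^ suc t * (- 1#) ^ suc t * 1#
      ≈⟨ trans (*-identityʳ _) ([-1]ⁿ[-1]ⁿ≈1 (suc t)) ⟩
    1# ∎
    where
    k+1≡2[t+1] : k ℕ.+ 1 ≡ suc t ℕ.+ suc t
    k+1≡2[t+1] = ≡.trans (≡.cong (ℕ._+ 1) k≡1+2t) (arith t)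
      where
      arith : ∀ t → 1 ℕ.+ t ℕ.* 2 ℕ.+ 1 ≡ suc t ℕ.+ suc t
      arith = solve-∀
    triangle-k≡[t+1]k : triangle k ≡ suc t ℕ.* k
    triangle-k≡[t+1]k = ≡.trans (≡.cong triangle k≡1+2t) (≡.trans (triangle-odd t)
                          (≡.trans (≡.cong (ℕ._* suc t) (≡.sym k≡1+2t)) (ℕ.*-comm k (suc t))))
  ... | t , inj₁ k≡2t = begin
    (- 1#) ^ (k ℕ.+ 1) * ζ ^ triangle k
      ≈⟨ *-cong (^-congʳ (- 1#) (ℕ.+-comm k 1)) (^-congʳ ζ triangle-k≡t[k+1]) ⟩
    (- 1#) ^ suc k * ζ ^ (t ℕ.* suc k)
      ≈⟨ *-congˡ (trans (sym (^-assocʳ ζ t (suc k))) (^-congˡ (suc k) ζ^t≈-1)) ⟩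
    (- 1#) ^ suc k * (- 1#) ^ suc k
      ≈⟨ [-1]ⁿ[-1]ⁿ≈1 (suc k) ⟩
    1# ∎
    where
    triangle-k≡t[k+1] : triangle k ≡ t ℕ.* suc k
    triangle-k≡t[k+1] = ≡.trans (≡.cong triangle k≡2t)
                          (≡.trans (triangle-even t) (≡.cong (λ n → t ℕ.* suc n) (≡.sym k≡2t)))
    t+t≡k : t ℕ.+ t ≡ k
    t+t≡k = ≡.trans (arith t) (≡.sym k≡2t)
      where
      arith : ∀ t → t ℕ.+ t ≡ t ℕ.* 2
      arith = solve-∀
    1≤t : 1 ℕ.≤ t
    1≤t = ℕ.n≢0⇒n>0 λ t≡0 → ℕ.1+n≢0 (≡.trans k≡2t (≡.cong (ℕ._* 2) t≡0))
    t<k : t ℕ.< k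
    t<k = ≡.subst (t ℕ.<_) t+t≡k (ℕ.m<m+n t 1≤t)
    ζ^t≈-1 : ζ ^ t ≈ - 1#
    ζ^t≈-1 = square-root-of-1 _≟_ (trans (sym (^-homo-* ζ t t)) (trans (^-congʳ ζ t+t≡k) ζ^k≈1))
                                  (ζ^j≉1 1≤t t<k)

  ∏ᶜ-powers : ∀ d n → ∏ᶜ n (λ j → (ζ ^ j) ^ d * 1#) ≈ (ζ ^ triangle n) ^ d
  ∏ᶜ-powers d zero    = sym (^-zeroˡ d)
  ∏ᶜ-powers d (suc n) = begin
    ∏ᶜ n (λ j → (ζ ^ j) ^ d * 1#) * ((ζ ^ suc n) ^ d * 1#)
      ≈⟨ *-cong (∏ᶜ-powers d n) (*-identityʳ _) ⟩
    (ζ ^ triangle n) ^ d * (ζ ^ suc n) ^ d   ≈⟨ ^-distrib-* _ _ d ⟨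
    (ζ ^ triangle n * ζ ^ suc n) ^ d         ≈⟨ ^-congˡ d (^-homo-* ζ (triangle n) (suc n)) ⟨
    (ζ ^ triangle (suc n)) ^ d               ∎

  conjugates : Poly F → ℕ → Poly F
  conjugates f j = f ⟨ ζ ^ j X⟩

  norm : ℕ → Poly F → Poly F
  norm d f = ((- 1#) ^ (d ℕ.* (k ℕ.+ 1))) • ∏ k (conjugates f)

  norm≋ : ∀ d f → sign F d k • ∏ k (λ j → f ⟨ pow F ζ j X⟩) ≋ norm d f
  norm≋ d f = •-cong (pow≈^ (- 1#) (d ℕ.* (k ℕ.+ 1))) (∏-cong k λ j → ⟨X⟩-cong (pow≈^ ζ j) ≋-refl)

  HasDegree-∏-conjugates : ∀ {f d} → Leading f d 1# → HasDegree (∏ k (conjugates f)) (k ℕ.* d)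
  HasDegree-∏-conjugates {f} {d} lf =
    ∏ᶜ k (λ j → (ζ ^ j) ^ d * 1#) ,
    (λ ∏≈0 → ^-≉0 d (^-≉0 (triangle k) ζ≉0) (trans (sym (∏ᶜ-powers d k)) ∏≈0)) ,
    Leading-∏ k (λ j → Leading-⟨X⟩ (ζ ^ j) lf)

  Leading-norm : ∀ {f d} → Leading f d 1# → Leading (norm d f) (k ℕ.* d) 1#
  Leading-norm {f} {d} lf = Leading-≈ sign·lead≈1
    (Leading-• ((- 1#) ^ (d ℕ.* (k ℕ.+ 1))) (Leading-∏ k (λ j → Leading-⟨X⟩ (ζ ^ j) lf)))
    where
    sign·lead≈1 : (- 1#) ^ (d ℕ.* (k ℕ.+ 1)) * ∏ᶜ k (λ j → (ζ ^ j) ^ d * 1#) ≈ 1#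
    sign·lead≈1 = begin
      (- 1#) ^ (d ℕ.* (k ℕ.+ 1)) * ∏ᶜ k (λ j → (ζ ^ j) ^ d * 1#)
        ≈⟨ *-congˡ (∏ᶜ-powers d k) ⟩
      (- 1#) ^ (d ℕ.* (k ℕ.+ 1)) * (ζ ^ triangle k) ^ d
        ≈⟨ *-congʳ (trans (^-congʳ (- 1#) (ℕ.*-comm d (k ℕ.+ 1))) (sym (^-assocʳ (- 1#) (k ℕ.+ 1) d))) ⟩
      ((- 1#) ^ (k ℕ.+ 1)) ^ d * (ζ ^ triangle k) ^ d
        ≈⟨ ^-distrib-* _ _ d ⟨
      ((- 1#) ^ (k ℕ.+ 1) * ζ ^ triangle k) ^ d
        ≈⟨ ^-congˡ d ∏-roots-sign ⟩
      1# ^ d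
        ≈⟨ ^-zeroˡ d ⟩
      1# ∎

  norm-invariant : ∀ d f → norm d f ⟨ ζ X⟩ ≋ norm d f
  norm-invariant d f = ≋.begin
    (s • ∏ k (conjugates f)) ⟨ ζ X⟩               ≋.≈⟨ ⟨X⟩-• ζ s (∏ k (conjugates f)) ⟩
    s • ∏ k (conjugates f) ⟨ ζ X⟩
      ≋.≈⟨ •-cong refl (∏-⟨X⟩ ζ k (conjugates f)) ⟩
    s • ∏ k (λ j → conjugates f j ⟨ ζ X⟩)
      ≋.≈⟨ •-cong refl (∏-cong k λ j → ⟨X⟩-⟨X⟩ ζ (ζ ^ j) f) ⟩
    s • ∏ k (conjugates f ∘ suc)
      ≋.≈⟨ •-cong refl (∏-rotate k′ (conjugates f) (⟨X⟩-cong ζ^[k+1]≈ζ ≋-refl)) ⟩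
    s • ∏ k (conjugates f) ≋.∎
    where
    s : Carrier
    s = (- 1#) ^ (d ℕ.* (k ℕ.+ 1))
    ζ^[k+1]≈ζ : ζ ^ suc k ≈ ζ ^ 1
    ζ^[k+1]≈ζ = *-congˡ ζ^k≈1

  norm-IsPolynomialInXᵏ : ∀ d f → IsPolynomialInXᵏ (norm d f)
  norm-IsPolynomialInXᵏ d f = invariant⇒IsPolynomialInXᵏ (norm-invariant d f) order-divides

  module _ (k-prime : Prime k) where

    order-of-ζ^t : ∀ {t s} → ¬ k ∣ t → (ζ ^ t) ^ s ≈ 1# → k ∣ s
    order-of-ζ^t {t} {s} k∤t ζ^ts≈1
      with euclidsLemma t s k-prime (order-divides (trans (sym (^-assocʳ ζ t s)) ζ^ts≈1))
    ... | inj₁ k∣t = ⊥-elim (k∤t k∣t)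
    ... | inj₂ k∣s = k∣s

module ConstructionStep {c ℓ c′ ℓ′} (F : CommutativeRing c ℓ) (isFieldF : IsField F)
                        (_≟F_ : ∀ x y → Dec (CommutativeRing._≈_ F x y))
                        (L : CommutativeRing c′ ℓ′) (isFieldL : IsField L)
                        (_≟L_ : ∀ x y → Dec (CommutativeRing._≈_ L x y))
                        (ι : CommutativeRing.Carrier F → CommutativeRing.Carrier L)
                        (ι-hom : IsEmbedding F L ι)
                        (k′ : ℕ) (ζ : CommutativeRing.Carrier F)
                        (ζ-primitive : IsPrimitiveRoot F (suc k′) ζ) (k-prime : Prime (suc k′)) where
  open CommutativeRing F hiding (zero)
  open RingProperties F
  open Polynomial F
  open PolynomialsOverField F isFieldF _≟F_
  open FieldProperties F isFieldF
  open RootOfUnity F isFieldF _≟F_ k′ ζ ζ-primitive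
  open Evaluation F L ι ι-hom
  open MinimalPolynomial F isFieldF _≟F_ L isFieldL ι ι-hom
  module L = CommutativeRing L
  open RingProperties L using () renaming (_^_ to _^ᴸ_; ^-distrib-* to ^ᴸ-distrib-*)
  open IsRingHomomorphism ι-hom using () renaming (⟦⟧-cong to ι-cong; 1#-homo to ι-1#)
  private
    module Lᶠ = FieldProperties L isFieldL

  decimation-preserves : ∀ {f g γ} → MonicIrreducibleRoot f γ → g ⟨X^ k ⟩ ≋ f → MonicIrreducibleRoot g (γ ^ᴸ k)
  decimation-preserves {f} {g} {γ} fm g⟨Xᵏ⟩≈f with zero-or-degree g
  ... | inj₁ g≈0 = ⊥-elim (1≉0 (Leading-[] (≋-trans (≋-sym g⟨Xᵏ⟩≈f) (⟨X^⟩-zero k g≈0)) monic))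
    where open MonicIrreducibleRoot fm
  ... | inj₂ (e , b , b≉0 , lg) = record { degree = e ; monic = g-monic ; irreducible = g-irr ; root = g-root }
    where
    open MonicIrreducibleRoot fm renaming (degree to d)
    lf : Leading f (e ℕ.* k) b
    lf = Leading-cong g⟨Xᵏ⟩≈f (Leading-⟨X^⟩ k′ lg)
    d≡ek : d ≡ e ℕ.* k
    d≡ek = Leading-degree-unique 1≉0 monic b≉0 lf
    g-monic : Leading g e 1#
    g-monic = Leading-≈ (Leading-coeff-unique lf (Leading-≡ d≡ek monic)) lg
    1≤e : 1 ℕ.≤ e
    1≤e = ℕ.n≢0⇒n>0 λ e≡0 → ℕ.<⇒≢ (Irreducible⇒1≤degree irreducible has-degree)
                                   (≡.sym (≡.trans d≡ek (≡.cong (ℕ._* k) e≡0)))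
    g-irr : Irreducible F g
    g-irr = (e , HasDegree⇒Deg (monic⇒HasDegree g-monic) , 1≤e) , λ a b g≈ab →
      Sum.map (IsUnitP-⟨X^⟩ k′) (IsUnitP-⟨X^⟩ k′) (irreducible-factors irreducible (a ⟨X^ k ⟩) (b ⟨X^ k ⟩)
        (≋-trans (≋-sym g⟨Xᵏ⟩≈f) (≋-trans (⟨X^⟩-cong k (≈P⇒≋ g≈ab)) (⟨X^⟩-⊛ k a b))))
    g-root : g ⟦ γ ^ᴸ k ⟧ L.≈ L.0#
    g-root = L.trans (L.sym (⟦⟨X^⟩⟧ k′ g γ)) (L.trans (⟦⟧-cong γ g⟨Xᵏ⟩≈f) root)

  factor-root : ∀ {p} a b x → p ≋ a ⊛ b → p ⟦ x ⟧ L.≈ L.0# → a ⟦ x ⟧ L.≈ L.0# ⊎ b ⟦ x ⟧ L.≈ L.0#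
  factor-root a b x p≈ab p[x]≈0 = Lᶠ.zero-product _≟L_ (⟦⟧-factor a b x p≈ab p[x]≈0)

  ∏-root : ∀ n h x → ∏ n h ⟦ x ⟧ L.≈ L.0# → ∃[ j ] (1 ℕ.≤ j × j ℕ.≤ n × h j ⟦ x ⟧ L.≈ L.0#)
  ∏-root zero    h x 1[x]≈0 = ⊥-elim (Lᶠ.1≉0 (L.trans (L.sym (L.trans (⟦const⟧ 1# x) ι-1#)) 1[x]≈0))
  ∏-root (suc n) h x ∏[x]≈0 with factor-root (∏ n h) (h (suc n)) x ≋-refl ∏[x]≈0
  ... | inj₂ h[x]≈0  = suc n , s≤s z≤n , ℕ.≤-refl , h[x]≈0
  ... | inj₁ ∏′[x]≈0 with ∏-root n h x ∏′[x]≈0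
  ...   | j , 1≤j , j≤n , h[x]≈0 = j , 1≤j , ℕ.m≤n⇒m≤1+n j≤n , h[x]≈0

  ⟦⟨X^k⟩⟧-rotate : ∀ h s x → h ⟨X^ k ⟩ ⟦ ι (ζ ^ s) L.* x ⟧ L.≈ h ⟦ x ^ᴸ k ⟧
  ⟦⟨X^k⟩⟧-rotate h s x = L.trans (⟦⟨X^⟩⟧ k′ h _) (⟦⟧-congʳ h (begin
    (ι (ζ ^ s) L.* x) ^ᴸ k          ≈⟨ ^ᴸ-distrib-* _ x k ⟩
    ι (ζ ^ s) ^ᴸ k L.* x ^ᴸ k       ≈⟨ L.*-congʳ (ι-^ (ζ ^ s) k) ⟨
    ι ((ζ ^ s) ^ k) L.* x ^ᴸ k      ≈⟨ L.*-congʳ (ι-cong (trans (^-assocʳ ζ s k) (ζ^[t*k]≈1 s))) ⟩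
    ι 1# L.* x ^ᴸ k                 ≈⟨ L.*-congʳ ι-1# ⟩
    L.1# L.* x ^ᴸ k                 ≈⟨ L.*-identityˡ _ ⟩
    x ^ᴸ k                          ∎))
    where open SetoidReasoning L.setoid

  module _ {f γ} (fm : MonicIrreducibleRoot f γ) (f∉Xᵏ : ¬ IsPolynomialInXᵏ f) where
    open MonicIrreducibleRoot fm renaming (degree to d)

    conjugate-multiple : ∀ {u} → ¬ u ≈ 0# → f ⟨ u X⟩ ⟦ γ ⟧ L.≈ L.0# → ∃[ c ] (f ⟨ u X⟩ ≋ c • f)
    conjugate-multiple {u} u≉0 fu[γ]≈0 with divides-vanishing has-degree irreducible root (f ⟨ u X⟩) fu[γ]≈0
    ... | Q , fu≈fQ with zero-or-degree Q
    ...   | inj₁ Q≈0 = ⊥-elim (*-≉0 (^-≉0 d u≉0) 1≉0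
                        (Leading-[] (≋-trans fu≈fQ (⊛-≋[]ʳ f Q≈0)) (Leading-⟨X⟩ u monic)))
    ...   | inj₂ (e , b , b≉0 , lQ) = b , fu≈bf
      where
      d≡d+e : d ≡ d ℕ.+ e
      d≡d+e = HasDegree-unique (_ , *-≉0 (^-≉0 d u≉0) 1≉0 , Leading-⟨X⟩ u monic)
                               (HasDegree-cong (≋-sym fu≈fQ) (HasDegree-⊛ has-degree (b , b≉0 , lQ)))
      e≡0 : e ≡ 0
      e≡0 = ℕ.+-cancelˡ-≡ d e 0 (≡.trans (≡.sym d≡d+e) (≡.sym (ℕ.+-identityʳ d)))
      fu≈bf : f ⟨ u X⟩ ≋ b • f
      fu≈bf = ≋.begin
        f ⟨ u X⟩        ≋.≈⟨ fu≈fQ ⟩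
        f ⊛ Q           ≋.≈⟨ ⊛-congʳ f (Leading⇒≋snoc (Leading-≡ e≡0 lQ)) ⟩
        f ⊛ (b ∷ [])    ≋.≈⟨ ⊛-comm f (b ∷ []) ⟩
        (b ∷ []) ⊛ f    ≋.≈⟨ const-⊛ b f ⟩
        b • f           ≋.∎

    coeff₀≉0 : 2 ℕ.≤ d → ¬ coeff f 0 ≈ 0#
    coeff₀≉0 2≤d f₀≈0 with irreducible-factors irreducible X (drop 1 f) (constant≈0⇒X-factor f f₀≈0)
    ... | inj₁ (a , _ , X≈a) = 1≉0 (coeff-≈ (≈P⇒≋ {X} {a ∷ []} X≈a) 1)
    ... | inj₂ (a , _ , f′≈a) =
      1≉0 (trans (sym (Leading.top monic)) (trans (coeff-≈ f≈Xa d) (coeff-linear 2≤d)))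
      where
      f≈Xa : f ≋ 0# ∷ a ∷ []
      f≈Xa = ≋-trans (constant≈0⇒X-factor f f₀≈0) (≋-trans (shift-⊛ (1# ∷ []) (drop 1 f))
               (∷-cong refl (≋-trans (⊛-identityˡ (drop 1 f)) (≈P⇒≋ {drop 1 f} {a ∷ []} f′≈a))))
      coeff-linear : ∀ {r} → 2 ℕ.≤ r → coeff (0# ∷ a ∷ []) r ≈ 0#
      coeff-linear (s≤s (s≤s _)) = refl

    conjugate-not-root : 2 ℕ.≤ d → ∀ {t} → 1 ℕ.≤ t → t ℕ.< k → ¬ f ⟦ ι (ζ ^ t) L.* γ ⟧ L.≈ L.0#
    conjugate-not-root 2≤d {t} 1≤t t<k f[ζᵗγ]≈0
      with conjugate-multiple (^-≉0 t ζ≉0) (L.trans (⟦⟨X⟩⟧ (ζ ^ t) f γ) f[ζᵗγ]≈0)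
    ... | c , fζᵗ≈cf = f∉Xᵏ (invariant⇒IsPolynomialInXᵏ fζᵗ≈f (order-of-ζ^t k-prime k∤t))
      where
      k∤t : ¬ k ∣ t
      k∤t k∣t = ℕ.<⇒≱ t<k (∣⇒≤ {{ℕ.>-nonZero 1≤t}} k∣t)
      c≈1 : c ≈ 1#
      c≈1 = *-identityˡ-unique (coeff₀≉0 2≤d) (begin
        c * coeff f 0                ≈⟨ coeff-• c f 0 ⟨
        coeff (c • f) 0              ≈⟨ coeff-≈ fζᵗ≈cf 0 ⟨
        coeff (f ⟨ ζ ^ t X⟩) 0       ≈⟨ coeff-⟨X⟩ (ζ ^ t) f 0 ⟩
        1# * coeff f 0               ≈⟨ *-identityˡ _ ⟩
        coeff f 0                    ∎)
        where open SetoidReasoning setoid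
      fζᵗ≈f : f ⟨ ζ ^ t X⟩ ≋ f
      fζᵗ≈f = ≋-trans fζᵗ≈cf (≋-trans (•-cong c≈1 ≋-refl) (•-identityˡ f))

    no-small-factor : ∀ {h e} → HasDegree h e → 1 ℕ.≤ e → e ℕ.< d → ¬ h ⟦ γ ^ᴸ k ⟧ L.≈ L.0#
    no-small-factor {h} {e} h-deg@(b , b≉0 , lh) 1≤e e<d h[γᵏ]≈0 = degree-clash (peel k ℕ.≤-refl)
      where
      φ : ℕ → Poly F
      φ = conjugates f
      M : Poly F
      M = h ⟨X^ k ⟩

      -- α s = ζ^(-s) γ for s ≤ k.
      α : ℕ → L.Carrier
      α s = ι (ζ ^ (k ∸ s)) L.* γ

      M[α]≈0 : ∀ s → M ⟦ α s ⟧ L.≈ L.0#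
      M[α]≈0 s = L.trans (⟦⟨X^k⟩⟧-rotate h (k ∸ s) γ) h[γᵏ]≈0

      φ[α]≉0 : ∀ {j r} → 1 ℕ.≤ j → j ℕ.≤ r → r ℕ.< k → ¬ φ j ⟦ α (suc r) ⟧ L.≈ L.0#
      φ[α]≉0 {j} {r} 1≤j j≤r r<k φ[α]≈0 =
        conjugate-not-root (ℕ.≤-trans (s≤s 1≤e) e<d) (ℕ.≤-trans 1≤j (ℕ.m≤m+n j _)) t<k f[ζᵗγ]≈0
        where
        t<k : j ℕ.+ (k ∸ suc r) ℕ.< k
        t<k = ℕ.<-≤-trans (ℕ.+-monoˡ-< (k ∸ suc r) (s≤s j≤r)) (ℕ.≤-reflexive (ℕ.m+[n∸m]≡n r<k))
        f[ζᵗγ]≈0 : f ⟦ ι (ζ ^ (j ℕ.+ (k ∸ suc r))) L.* γ ⟧ L.≈ L.0#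
        f[ζᵗγ]≈0 = L.trans (⟦⟧-congʳ f (L.trans (L.*-congʳ (ι-cong (^-homo-* ζ j _)))
                                                 (L.sym (ι-*-assoc _ _ γ))))
                           (L.trans (L.sym (⟦⟨X⟩⟧ (ζ ^ j) f (α (suc r)))) φ[α]≈0)

      -- No conjugate peeled off so far vanishes at α (r+1), so the cofactor N does; then f divides
      -- N(ζ^(-(r+1)) X), i.e. f(ζ^(r+1) X) divides N.
      peel-step : ∀ {r} → r ℕ.< k → ∀ N → M ≋ ∏ r φ ⊛ N → ∃[ N′ ] (M ≋ ∏ (suc r) φ ⊛ N′)
      peel-step {r} r<k N M≈∏N with factor-root (∏ r φ) N (α (suc r)) M≈∏N (M[α]≈0 (suc r))
      ... | inj₁ ∏[α]≈0 with ∏-root r φ _ ∏[α]≈0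
      ...   | j , 1≤j , j≤r , φ[α]≈0 = ⊥-elim (φ[α]≉0 1≤j j≤r r<k φ[α]≈0)
      peel-step {r} r<k N M≈∏N | inj₂ N[α]≈0 = Q ⟨ u X⟩ , M≈∏′Q′
        where
        u : Carrier
        u = ζ ^ suc r
        v : Carrier
        v = ζ ^ (k ∸ suc r)
        uv≈1 : u * v ≈ 1#
        uv≈1 = trans (sym (^-homo-* ζ (suc r) _)) (trans (^-congʳ ζ (ℕ.m+[n∸m]≡n r<k)) ζ^k≈1)
        S : Poly F
        S = N ⟨ v X⟩
        S-factor : ∃[ Q ] (S ≋ f ⊛ Q)
        S-factor = divides-vanishing has-degree irreducible root S (L.trans (⟦⟨X⟩⟧ v N γ) N[α]≈0)
        Q : Poly F
        Q = proj₁ S-factor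
        N≈φQ : N ≋ φ (suc r) ⊛ Q ⟨ u X⟩
        N≈φQ = ≋.begin
          N                      ≋.≈⟨ ⟨1X⟩ N ⟨
          N ⟨ 1# X⟩              ≋.≈⟨ ⟨X⟩-cong uv≈1 ≋-refl ⟨
          N ⟨ u * v X⟩           ≋.≈⟨ ⟨X⟩-⟨X⟩ u v N ⟨
          S ⟨ u X⟩               ≋.≈⟨ ⟨X⟩-cong refl (proj₂ S-factor) ⟩
          (f ⊛ Q) ⟨ u X⟩         ≋.≈⟨ ⟨X⟩-⊛ u f Q ⟩
          φ (suc r) ⊛ Q ⟨ u X⟩   ≋.∎
        M≈∏′Q′ : M ≋ ∏ (suc r) φ ⊛ Q ⟨ u X⟩
        M≈∏′Q′ = ≋.begin
          M                                   ≋.≈⟨ M≈∏N ⟩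
          ∏ r φ ⊛ N                           ≋.≈⟨ ⊛-congʳ (∏ r φ) N≈φQ ⟩
          ∏ r φ ⊛ (φ (suc r) ⊛ Q ⟨ u X⟩)      ≋.≈⟨ ⊛-assoc (∏ r φ) (φ (suc r)) (Q ⟨ u X⟩) ⟨
          ∏ (suc r) φ ⊛ Q ⟨ u X⟩              ≋.∎

      peel : ∀ r → r ℕ.≤ k → ∃[ N ] (M ≋ ∏ r φ ⊛ N)
      peel zero    _   = M , ≋-sym (⊛-identityˡ M)
      peel (suc r) r<k = uncurry (peel-step r<k) (peel r (ℕ.<⇒≤ r<k))

      degree-clash : ¬ (∃[ N ] (M ≋ ∏ k φ ⊛ N))
      degree-clash (N , M≈∏N) with zero-or-degree N
      ... | inj₁ N≈0 = b≉0 (Leading-[] (≋-trans M≈∏N (⊛-≋[]ʳ (∏ k φ) N≈0)) (Leading-⟨X^⟩ k′ lh))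
      ... | inj₂ (e′ , N-deg) =
        ℕ.<⇒≱ e<d (ℕ.*-cancelʳ-≤ d e k (≡.subst (ℕ._≤ e ℕ.* k) (ℕ.*-comm k d) kd≤ek))
        where
        ek≡kd+e′ : e ℕ.* k ≡ k ℕ.* d ℕ.+ e′
        ek≡kd+e′ = HasDegree-unique (b , b≉0 , Leading-⟨X^⟩ k′ lh)
                     (HasDegree-cong (≋-sym M≈∏N) (HasDegree-⊛ (HasDegree-∏-conjugates monic) N-deg))
        kd≤ek : k ℕ.* d ℕ.≤ e ℕ.* k
        kd≤ek = ≡.subst (k ℕ.* d ℕ.≤_) (≡.sym ek≡kd+e′) (ℕ.m≤m+n (k ℕ.* d) e′)

    norm-root : norm d f ⟦ γ ⟧ L.≈ L.0#
    norm-root = begin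
      norm d f ⟦ γ ⟧                                          ≈⟨ ⟦•⟧ _ (∏ k (conjugates f)) γ ⟩
      ι ((- 1#) ^ (d ℕ.* (k ℕ.+ 1))) L.* ∏ k (conjugates f) ⟦ γ ⟧
        ≈⟨ L.*-congˡ (⟦⊛⟧ (∏ k′ (conjugates f)) (conjugates f k) γ) ⟩
      _ L.* (∏ k′ (conjugates f) ⟦ γ ⟧ L.* conjugates f k ⟦ γ ⟧)  ≈⟨ L.*-congˡ (L.*-congˡ fζᵏ[γ]≈0) ⟩
      _ L.* (_ L.* L.0#)                                      ≈⟨ L.trans (L.*-congˡ (L.zeroʳ _)) (L.zeroʳ _) ⟩
      L.0#                                                    ∎
      where
      open SetoidReasoning L.setoid
      fζᵏ[γ]≈0 : conjugates f k ⟦ γ ⟧ L.≈ L.0#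
      fζᵏ[γ]≈0 = L.trans (⟦⟧-cong γ (≋-trans (⟨X⟩-cong ζ^k≈1 ≋-refl) (⟨1X⟩ f))) root

    norm-preserves : ∀ {g} → g ⟨X^ k ⟩ ≋ norm d f → MonicIrreducibleRoot g (γ ^ᴸ k)
    norm-preserves {g} g⟨Xᵏ⟩≈N with zero-or-degree g
    ... | inj₁ g≈0 = ⊥-elim (1≉0 (Leading-[] (≋-trans (≋-sym g⟨Xᵏ⟩≈N) (⟨X^⟩-zero k g≈0)) (Leading-norm monic)))
    ... | inj₂ (e , b , b≉0 , lg) = record { degree = d ; monic = g-monic ; irreducible = g-irr ; root = g-root }
      where
      lN : Leading (norm d f) (e ℕ.* k) b
      lN = Leading-cong g⟨Xᵏ⟩≈N (Leading-⟨X^⟩ k′ lg)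
      kd≡ek : k ℕ.* d ≡ e ℕ.* k
      kd≡ek = Leading-degree-unique 1≉0 (Leading-norm monic) b≉0 lN
      e≡d : e ≡ d
      e≡d = ℕ.*-cancelʳ-≡ e d k (≡.trans (≡.sym kd≡ek) (ℕ.*-comm k d))
      g-monic : Leading g d 1#
      g-monic = Leading-≡ e≡d (Leading-≈ (Leading-coeff-unique lN (Leading-≡ kd≡ek (Leading-norm monic))) lg)
      g-root : g ⟦ γ ^ᴸ k ⟧ L.≈ L.0#
      g-root = L.trans (L.sym (⟦⟨X^⟩⟧ k′ g γ)) (L.trans (⟦⟧-cong γ g⟨Xᵏ⟩≈N) norm-root)
      g≉0 : ¬ g ≋ []
      g≉0 g≈0 = 1≉0 (Leading-[] g≈0 g-monic)
      factor : ∀ a b → g ≋ a ⊛ b → IsUnitP F a ⊎ IsUnitP F b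
      factor a b g≈ab with zero-or-degree a | zero-or-degree b
      ... | inj₁ a≈0 | _ = ⊥-elim (g≉0 (≋-trans g≈ab (⊛-≋[]ˡ b a≈0)))
      ... | inj₂ _   | inj₁ b≈0 = ⊥-elim (g≉0 (≋-trans g≈ab (⊛-≋[]ʳ a b≈0)))
      ... | inj₂ (zero , a-deg)  | inj₂ _ = inj₁ (HasDegree⇒IsUnitP a-deg)
      ... | inj₂ (suc _ , _)     | inj₂ (zero , b-deg) = inj₂ (HasDegree⇒IsUnitP b-deg)
      ... | inj₂ (suc e₁ , a-deg) | inj₂ (suc e₂ , b-deg) =
        ⊥-elim ([ no-small-factor a-deg (s≤s z≤n) e₁<d , no-small-factor b-deg (s≤s z≤n) e₂<d ]′
                  (factor-root a b (γ ^ᴸ k) g≈ab g-root))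
        where
        d≡e₁+e₂ : d ≡ suc e₁ ℕ.+ suc e₂
        d≡e₁+e₂ = HasDegree-unique (monic⇒HasDegree g-monic)
                                   (HasDegree-cong (≋-sym g≈ab) (HasDegree-⊛ a-deg b-deg))
        e₁<d : suc e₁ ℕ.< d
        e₁<d = ≡.subst (suc e₁ ℕ.<_) (≡.sym d≡e₁+e₂) (ℕ.m<m+n (suc e₁) (s≤s z≤n))
        e₂<d : suc e₂ ℕ.< d
        e₂<d = ≡.subst (suc e₂ ℕ.<_) (≡.sym d≡e₁+e₂) (ℕ.m<n+m (suc e₂) (s≤s z≤n))
      g-irr : Irreducible F g
      g-irr = (d , HasDegree⇒Deg (monic⇒HasDegree g-monic) , Irreducible⇒1≤degree irreducible has-degree) ,
              λ a b g≈ab → factor a b (≈P⇒≋ g≈ab)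

  step-exists : ∀ {f d} → Leading f d 1# → ∃[ g ] Step F k ζ f g
  step-exists {f} {d} lf with IsPolynomialInXᵏ? f
  ... | yes (G , G⟨Xᵏ⟩≈f) = G , inj₁ (≋⇒≈P G⟨Xᵏ⟩≈f)
  ... | no f∉Xᵏ = G , inj₂ ((λ (G′ , e) → f∉Xᵏ (G′ , ≈P⇒≋ e)) , d , HasDegree⇒Deg (monic⇒HasDegree lf) ,
                           ≋⇒≈P (≋-trans G⟨Xᵏ⟩≈N (≋-sym (norm≋ d f))))
    where
    G : Poly F
    G = proj₁ (norm-IsPolynomialInXᵏ d f)
    G⟨Xᵏ⟩≈N : G ⟨X^ k ⟩ ≋ norm d f
    G⟨Xᵏ⟩≈N = proj₂ (norm-IsPolynomialInXᵏ d f)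

  step-preserves : ∀ {f g γ} → MonicIrreducibleRoot f γ → Step F k ζ f g → MonicIrreducibleRoot g (γ ^ᴸ k)
  step-preserves fm (inj₁ g⟨Xᵏ⟩≈f) = decimation-preserves fm (≈P⇒≋ g⟨Xᵏ⟩≈f)
  step-preserves {f} {g} fm (inj₂ (f∉Xᵏ , d′ , f-deg′ , g⟨Xᵏ⟩≈N′)) =
    norm-preserves fm (λ (G , e) → f∉Xᵏ (G , ≋⇒≈P e))
      (≋-trans (≈P⇒≋ g⟨Xᵏ⟩≈N′) (≡.subst (λ e → _ ≋ norm e f) d′≡d (norm≋ d′ f)))
    where
    open MonicIrreducibleRoot fm
    d′≡d : d′ ≡ degree
    d′≡d = HasDegree-unique (Deg⇒HasDegree f-deg′) has-degree

module Construction {c ℓ c′ ℓ′} (F : CommutativeRing c ℓ) (isFieldF : IsField F)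
                    (_≟F_ : ∀ x y → Dec (CommutativeRing._≈_ F x y))
                    (L : CommutativeRing c′ ℓ′) (isFieldL : IsField L)
                    (_≟L_ : ∀ x y → Dec (CommutativeRing._≈_ L x y))
                    (ι : CommutativeRing.Carrier F → CommutativeRing.Carrier L)
                    (ι-hom : IsEmbedding F L ι) where
  open CommutativeRing L
  open RingProperties L
  open Polynomial F using (≋-refl; ≋-sym; ≈P⇒≋; ≋⇒≈P)
  open MinimalPolynomial F isFieldF _≟F_ L isFieldL ι ι-hom
  private
    module OneStep = ConstructionStep F isFieldF _≟F_ L isFieldL _≟L_ ι ι-hom

  prime≢0 : ∀ {k} → Prime k → k ≡.≢ 0
  prime≢0 k-prime = ℕ.≢-nonZero⁻¹ _ {{prime⇒nonZero k-prime}}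

  step-exists : ∀ {k ζ f γ} → Prime k → IsPrimitiveRoot F k ζ →
                MonicIrreducibleRoot f γ → ∃[ g ] Step F k ζ f g
  step-exists {zero}   k-prime _       _  = ⊥-elim (prime≢0 k-prime ≡.refl)
  step-exists {suc k′} k-prime ζ-prim fm = OneStep.step-exists k′ _ ζ-prim k-prime (MonicIrreducibleRoot.monic fm)

  step-preserves : ∀ {k ζ f g γ} → Prime k → IsPrimitiveRoot F k ζ →
                   MonicIrreducibleRoot f γ → Step F k ζ f g → MonicIrreducibleRoot g (γ ^ k)
  step-preserves {zero}   k-prime _      _  _ = ⊥-elim (prime≢0 k-prime ≡.refl)
  step-preserves {suc k′} k-prime ζ-prim fm s = OneStep.step-preserves k′ _ ζ-prim k-prime fm s

  Steps : ∀ m → (Fin m → ℕ) → (Fin m → CommutativeRing.Carrier F) → (Fin (suc m) → Poly F) → Set (c ⊔ ℓ)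
  Steps m ks ζs fs = ∀ i → Step F (ks i) (ζs i) (fs (inject₁ i)) (fs (Fin.suc i))

  steps-exist : ∀ m {ks ζs} → (∀ i → Prime (ks i)) → (∀ i → IsPrimitiveRoot F (ks i) (ζs i)) →
                ∀ {f γ} → MonicIrreducibleRoot f γ → ∃[ fs ] (fs Fin.zero ≡ f × Steps m ks ζs fs)
  steps-exist zero    _        _       {f} _  = (λ _ → f) , ≡.refl , λ ()
  steps-exist (suc m) ks-prime ζs-prim {f} fm with step-exists (ks-prime Fin.zero) (ζs-prim Fin.zero) fm
  ... | g , f→g with steps-exist m (ks-prime ∘ Fin.suc) (ζs-prim ∘ Fin.suc)
                       (step-preserves (ks-prime Fin.zero) (ζs-prim Fin.zero) fm f→g)
  ...   | gs , gs₀≡g , gs-steps = fs , ≡.refl , steps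
    where
    fs : Fin (suc (suc m)) → Poly F
    fs Fin.zero    = f
    fs (Fin.suc i) = gs i
    steps : Steps (suc m) _ _ fs
    steps Fin.zero    = ≡.subst (Step F _ _ f) (≡.sym gs₀≡g) f→g
    steps (Fin.suc i) = gs-steps i

  steps-preserve : ∀ m {ks ζs} → (∀ i → Prime (ks i)) → (∀ i → IsPrimitiveRoot F (ks i) (ζs i)) →
                   ∀ {fs γ} → MonicIrreducibleRoot (fs Fin.zero) γ → Steps m ks ζs fs →
                   (∀ i → ∃[ δ ] MonicIrreducibleRoot (fs i) δ)
                   × MonicIrreducibleRoot (fs (fromℕ m)) (γ ^ prodFin m ks)
  steps-preserve zero _ _ {γ = γ} fm _ =
    (λ { Fin.zero → γ , fm }) , MonicIrreducibleRoot-cong ≋-refl (sym (*-identityʳ γ)) fm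
  steps-preserve (suc m) {ks} ks-prime ζs-prim {fs} {γ} fm steps
    with steps-preserve m (ks-prime ∘ Fin.suc) (ζs-prim ∘ Fin.suc) {fs ∘ Fin.suc}
           (step-preserves (ks-prime Fin.zero) (ζs-prim Fin.zero) fm (steps Fin.zero)) (steps ∘ Fin.suc)
  ... | all , last = (λ { Fin.zero → γ , fm ; (Fin.suc i) → all i }) ,
                     MonicIrreducibleRoot-cong ≋-refl (^-assocʳ γ (ks Fin.zero) _) last

  chain-exists : ∀ m {ks ζs} → (∀ i → Prime (ks i)) → (∀ i → IsPrimitiveRoot F (ks i) (ζs i)) →
                 ∀ {f γ} → MonicIrreducibleRoot f γ → ∃[ fs ] Chain F m ks ζs f fs
  chain-exists m ks-prime ζs-prim fm with steps-exist m ks-prime ζs-prim fm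
  ... | fs , ≡.refl , steps = fs , ≋⇒≈P ≋-refl , steps

  chain-minimal : ∀ m {ks ζs} → (∀ i → Prime (ks i)) → (∀ i → IsPrimitiveRoot F (ks i) (ζs i)) →
                  ∀ {f γ fs} → MonicIrreducibleRoot f γ → Chain F m ks ζs f fs →
                  (∀ i → ∃[ d ] (MonicDeg F (fs i) d × Irreducible F (fs i)))
                  × IsMinimalPolynomial F L ι (fs (fromℕ m)) (pow L γ (prodFin m ks))
  chain-minimal m {ks} ks-prime ζs-prim {γ = γ} fm (fs₀≈f , steps)
    with steps-preserve m ks-prime ζs-prim (MonicIrreducibleRoot-cong (≋-sym (≈P⇒≋ fs₀≈f)) refl fm) steps
  ... | all , last =
    (λ i → MonicIrreducibleRoot⇒MonicIrreducible (proj₂ (all i))) ,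
    MonicIrreducibleRoot⇒IsMinimalPolynomial
      (MonicIrreducibleRoot-cong ≋-refl (sym (pow≈^ γ (prodFin m ks))) last)

decidable-≈ : ∀ {c ℓ} (R : CommutativeRing c ℓ) {q} → HasCard R q →
              ∀ x y → Dec (CommutativeRing._≈_ R x y)
decidable-≈ R card x y with Inverse.to card x Finₚ.≟ Inverse.to card y
... | yes tx≡ty = yes (begin
  x             ≈⟨ strictlyInverseʳ x ⟨
  from (to x)   ≈⟨ from-cong tx≡ty ⟩
  from (to y)   ≈⟨ strictlyInverseʳ y ⟩
  y             ∎)
  where
  open Inverse card
  open SetoidReasoning (CommutativeRing.setoid R)
... | no tx≢ty = no (tx≢ty ∘ Inverse.to-cong card)

open import Data.Nat using (_^_)
open CommutativeRing using (Carrier; _≈_; 0#)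

mainTheorem6 : ∀ {c ℓ c′ ℓ′}
    (F : CommutativeRing c ℓ) → IsField F →
    (q : ℕ) → IsPrimePower q → HasCard F q →
    (m : ℕ) (ks : Fin m → ℕ) → (∀ i → Prime (ks i) × ks i ∣ q ∸ 1) →
    (ζs : Fin m → Carrier F) → (∀ i → IsPrimitiveRoot F (ks i) (ζs i)) →
    (f : Poly F) (n : ℕ) → MonicDeg F f n → Irreducible F f →
    (L : CommutativeRing c′ ℓ′) → IsField L → HasCard L (q ^ n) →
    (ι : Carrier F → Carrier L) → IsEmbedding F L ι →
    (β : Carrier L) → _≈_ L (evalAt F L ι f β) (0# L) →
    (∃[ fs ] Chain F m ks ζs f fs)
    × (∀ fs → Chain F m ks ζs f fs →
         (∀ i → ∃[ d ] (MonicDeg F (fs i) d × Irreducible F (fs i)))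
         × IsMinimalPolynomial F L ι (fs (fromℕ m)) (pow L β (prodFin m ks)))
mainTheorem6 F isFieldF _ _ F-card m ks ks-props ζs ζs-primitive f n f-monic f-irr
             L isFieldL L-card ι ι-hom β f[β]≈0 =
  chain-exists m ks-prime ζs-primitive f-root , λ _ → chain-minimal m ks-prime ζs-primitive f-root
  where
  open Polynomial F using (MonicDeg⇒Leading)
  open MinimalPolynomial F isFieldF (decidable-≈ F F-card) L isFieldL ι ι-hom
  open Construction F isFieldF (decidable-≈ F F-card) L isFieldL (decidable-≈ L L-card) ι ι-hom

  ks-prime : ∀ i → Prime (ks i)
  ks-prime i = proj₁ (ks-props i)

  f-root : MonicIrreducibleRoot f β
  f-root = record { degree = n ; monic = MonicDeg⇒Leading f-monic ; irreducible = f-irr ; root = f[β]≈0 }
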